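{- Let $m\ge 1$ and $c\ge 1$, and for each department $d\in[c]$ let $n_d\ge 0$ and $k_d\in\{0,\dots,m\}$. All committees are chosen independently: department $d$ chooses $n_d$ subsets of $[m]$, each uniformly random of size $k_d$. Let $X_\cap$ be the number of elements of $[m]$ lying in at least one committee of every department. Then for $0\le i\le m$, $$\mathbb{P}[X_\cap=i]=\binom{m}{i}\Delta^{m-i}\Big\{\prod_{d=1}^c\nabla^{m-y}\Big[\frac{\binom{x}{k_d}^{n_d}}{\binom{m}{k_d}^{n_d}}\Big]_{x=m}\Big\}_{y=0}=\binom{m}{i}\sum_{j=0}^{m-i}(-1)^j\binom{m-i}{j}\prod_{d=1}^c\sum_{l=0}^{i+j}(-1)^{l}\binom{i+j}{l}\Big(\frac{\binom{m-l}{k_d}}{\binom{m}{k_d}}\Big)^{n_d},$$ and for $r\ge 0$, $$\mathbb{E}\Big[\binom{X_\cap}{r}\Big]=\binom{m}{r}\prod_{d=1}^c\nabla^r\Big\{\Big[\frac{\binom{x}{k_d}}{\binom{m}{k_d}}\Big]^{n_d}\Big\}_{x=m}.$$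
   Context: $\nabla f(x)=f(x)-f(x-1)$ and $\Delta f(x)=f(x+1)-f(x)$ are the backward and forward difference operators with iterates $\nabla^r,\Delta^r$; in the first formula $\nabla^{m-y}$ acts on the variable $x$ (then evaluated at $x=m$), and $\Delta^{m-i}$ acts on the variable $y$ (then evaluated at $y=0$); $\binom{x}{k}=x(x-1)\cdots(x-k+1)/k!$. -}

module Defs where

open import Data.Nat as ℕ using (ℕ; zero; suc; _∸_)
open import Data.Nat.Combinatorics using (_C_)
open import Data.Integer as ℤ using (ℤ; +_)
open import Data.Rational as ℚ using (ℚ; 0ℚ; 1ℚ; _+_; _*_; _-_; -_; _÷_; ≢-nonZero)
open import Data.Rational.Properties using (_≟_)
open import Data.Fin using (Fin; zero; suc)
open import Data.Fin.Subset using (Subset; inside; outside; ⋃; ⋂; ∣_∣)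
open import Data.Vec as Vec using (Vec; []; _∷_)
open import Data.List as List using (List; []; _∷_; concatMap; filter; length; map)
open import Relation.Nullary using (yes; no)

ι : ℕ → ℚ
ι n = (+ n) ℚ./ 1

infixl 7 _÷₀_
infixr 8 _^_

-- total division on ℚ (x ÷₀ 0 = 0); only ever applied to nonzero denominators
_÷₀_ : ℚ → ℚ → ℚ
p ÷₀ q with q ≟ 0ℚ
... | yes _ = 0ℚ
... | no q≢0 = _÷_ p q {{≢-nonZero q≢0}}

_^_ : ℚ → ℕ → ℚ
p ^ zero = 1ℚ
p ^ suc n = p * (p ^ n)

Σ≤ : ℕ → (ℕ → ℚ) → ℚ
Σ≤ zero f = f 0
Σ≤ (suc n) f = Σ≤ n f + f (suc n)

∏ : (c : ℕ) → (Fin c → ℚ) → ℚ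
∏ zero f = 1ℚ
∏ (suc c) f = f zero * ∏ c (λ d → f (suc d))

-- generalized binomial  binom x k = x(x-1)⋯(x-k+1)/k!  for integer x
binom : ℤ → ℕ → ℚ
binom x zero = 1ℚ
binom x (suc k) = binom x k * ((x ℤ.- + k) ℚ./ suc k)

∇ : (ℤ → ℚ) → (ℤ → ℚ)
∇ f x = f x - f (x ℤ.- + 1)

∇^ : ℕ → (ℤ → ℚ) → (ℤ → ℚ)
∇^ zero f = f
∇^ (suc r) f = ∇ (∇^ r f)

Δ : (ℕ → ℚ) → (ℕ → ℚ)
Δ f y = f (suc y) - f y

Δ^ : ℕ → (ℕ → ℚ) → (ℕ → ℚ)
Δ^ zero f = f
Δ^ (suc r) f = Δ (Δ^ r f)

allSubsets : (m : ℕ) → List (Subset m)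
allSubsets zero = [] ∷ []
allSubsets (suc m) = concatMap (λ s → (inside ∷ s) ∷ (outside ∷ s) ∷ []) (allSubsets m)

committees : (m k : ℕ) → List (Subset m)
committees m k = filter (λ s → ∣ s ∣ ℕ.≟ k) (allSubsets m)

tuples : {A : Set} → List A → (n : ℕ) → List (Vec A n)
tuples xs zero = [] ∷ []
tuples xs (suc n) = concatMap (λ x → map (x ∷_) (tuples xs n)) xs

depFuns : (c : ℕ) {A : Fin c → Set} → ((d : Fin c) → List (A d)) → List ((d : Fin c) → A d)
depFuns zero E = (λ ()) ∷ []
depFuns (suc c) {A} E =
  concatMap (λ a → map (λ f → cons a f) (depFuns c (λ d → E (suc d)))) (E zero)
  where
  cons : A zero → ((d : Fin c) → A (suc d)) → (d : Fin (suc c)) → A d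
  cons a f zero = a
  cons a f (suc d) = f d

Outcome : (m c : ℕ) → (n : Fin c → ℕ) → Set
Outcome m c n = (d : Fin c) → Vec (Subset m) (n d)

-- the sample space (each outcome equally likely): the committees are
-- independent and uniform among k_d-subsets of [m]
outcomes : (m c : ℕ) (n k : Fin c → ℕ) → List (Outcome m c n)
outcomes m c n k = depFuns c (λ d → tuples (committees m (k d)) (n d))

Xcap : {m c : ℕ} {n : Fin c → ℕ} → Outcome m c n → ℕ
Xcap {m} {c} ω = ∣ ⋂ (List.tabulate (λ d → ⋃ (Vec.toList (ω d)))) ∣

probX : (m c : ℕ) (n k : Fin c → ℕ) → ℕ → ℚ
probX m c n k i =
  ι (length (filter (λ ω → Xcap ω ℕ.≟ i) (outcomes m c n k))) ÷₀ ι (length (outcomes m c n k))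

expBinomX : (m c : ℕ) (n k : Fin c → ℕ) → ℕ → ℚ
expBinomX m c n k r =
  List.foldr _+_ 0ℚ (map (λ ω → ι (Xcap ω C r)) (outcomes m c n k)) ÷₀ ι (length (outcomes m c n k))

module Submission where

-- Double counting the pairs (outcome, r-set T inside the covered set), and
-- using independence of departments and of committees, gives
--   Σ_ω B(X_∩ ω, r) = B(m,r) ∏_d #{n_d-tuples of k_d-sets whose union ⊇ T}.
-- The inner count is computed by inclusion–exclusion on "patterns" (each
-- element must be covered / must be avoided / is free): every "must" turns
-- into a backward difference, so it equals ∇^r [binom(x,k_d)^{n_d}] at x = m.
-- Dividing by the size ∏_d B(m,k_d)^{n_d} of the sample space (the case
-- r = 0) gives the moment formula.  Binomial inversion (an alternating
-- Pascal row sum together with trinomial revision) turns the moments into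
-- P[X_∩ = i]; expanding the forward and backward differences as alternating
-- binomial sums gives the two displayed forms.

open import Defs
open import Data.Nat using (ℕ; zero; suc; _≤_; _<_; _∸_; z≤n; s≤s; _!) renaming (_+_ to _+ℕ_)
import Data.Nat as ℕ
import Data.Nat.Properties as ℕP
import Data.Nat.Tactic.RingSolver as ℕSolver
open import Data.Nat.Combinatorics
  using (_C_; nCk+nC[k+1]≡[n+1]C[k+1]; nCk≡n!/k![n-k]!; k![n∸k]!∣n!; nCk≡nC[n∸k])
open import Data.Nat.DivMod using (m/n*n≡m)
import Data.Nat.Coprimality as Coprime
open import Data.Integer using (ℤ; +_)
import Data.Integer as ℤ
import Data.Integer.Properties as ℤP
import Data.Integer.Tactic.RingSolver as ℤSolver
open import Data.Rational using (ℚ; mkℚ; 0ℚ; 1ℚ; _+_; _*_; _-_; -_; 1/_; ≢-nonZero)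
import Data.Rational as ℚ
import Data.Rational.Properties as ℚP
import Data.Rational.Unnormalised as ℚᵘ
import Data.Rational.Unnormalised.Properties as ℚᵘP
open import Data.Bool using (Bool; true; false; _∧_; not; if_then_else_)
import Data.Bool as Bool
open import Data.Bool.Properties using (∧-commutativeMonoid)
open import Algebra.Bundles using (CommutativeMonoid)
open import Algebra.Properties.CommutativeSemigroup (CommutativeMonoid.commutativeSemigroup ∧-commutativeMonoid)
  using (interchange)
open import Data.Fin using (Fin; zero; suc)
open import Data.Fin.Subset using (Subset; inside; outside; ⋃; ⋂; ∣_∣; _∪_; _∩_; ⊤; ⊥)
open import Data.Fin.Subset.Properties using (∣p∣≤n; ∣⊤∣≡n)
open import Data.Vec using (Vec; []; _∷_)
import Data.Vec as Vec
open import Data.List using (List; []; _∷_; concatMap; filter; length; map; _++_)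
import Data.List as List
open import Data.Maybe using (Maybe; just; nothing)
open import Data.Product using (_×_; _,_)
open import Relation.Binary.PropositionalEquality
open import Relation.Binary.Definitions using (Tri; tri<; tri≈; tri>)
open import Relation.Nullary using (yes; no; ¬_; Dec; does; contradiction)
open import Relation.Nullary.Decidable using (dec-true; dec-false)
open import Tactic.RingSolver using (solve-∀)
open import Tactic.RingSolver.Core.AlmostCommutativeRing using (AlmostCommutativeRing; fromCommutativeRing)

ℚ-ring : AlmostCommutativeRing _ _
ℚ-ring = fromCommutativeRing ℚP.+-*-commutativeRing isZero
  where
  isZero : (x : ℚ) → Maybe (0ℚ ≡ x)
  isZero x with 0ℚ ℚP.≟ x
  ... | yes p = just p
  ... | no _ = nothing

-- The embedding ι : ℕ → ℚ is a semiring homomorphism.  Its values are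
-- already normalised fractions n/1, which lets us compute with them in ℚᵘ.
ι-normal : ∀ n → ι n ≡ mkℚ (+ n) 0 (Coprime.sym (Coprime.1-coprimeTo n))
ι-normal n = ℚP.normalize-coprime (Coprime.sym (Coprime.1-coprimeTo n))

ι-toℚᵘ : ∀ n → ℚ.toℚᵘ (ι n) ℚᵘ.≃ ℚᵘ.mkℚᵘ (+ n) 0
ι-toℚᵘ n rewrite ι-normal n = ℚᵘP.≃-refl

ι-suc : ∀ n → ι (suc n) ≡ 1ℚ + ι n
ι-suc n = ℚP.toℚᵘ-injective (ℚᵘP.≃-trans (ι-toℚᵘ (suc n)) (ℚᵘP.≃-sym (ℚᵘP.≃-trans
  (ℚP.toℚᵘ-homo-+ 1ℚ (ι n)) (ℚᵘP.≃-trans (ℚᵘP.+-congʳ (ℚ.toℚᵘ 1ℚ) (ι-toℚᵘ n)) (ℚᵘ.*≡* (normal (+ n)))))))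
  where
  normal : ∀ x → (+ 1 ℤ.* + 1 ℤ.+ x ℤ.* + 1) ℤ.* + 1 ≡ (+ 1 ℤ.+ x) ℤ.* (+ 1 ℤ.* + 1)
  normal = ℤSolver.solve-∀

ι-+ : ∀ a b → ι (a +ℕ b) ≡ ι a + ι b
ι-+ zero b = sym (ℚP.+-identityˡ (ι b))
ι-+ (suc a) b = begin
  ι (suc (a +ℕ b))    ≡⟨ ι-suc (a +ℕ b) ⟩
  1ℚ + ι (a +ℕ b)     ≡⟨ cong (λ x → 1ℚ + x) (ι-+ a b) ⟩
  1ℚ + (ι a + ι b)    ≡⟨ ℚP.+-assoc 1ℚ (ι a) (ι b) ⟨
  (1ℚ + ι a) + ι b    ≡⟨ cong (_+ ι b) (ι-suc a) ⟨
  ι (suc a) + ι b     ∎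
  where open ≡-Reasoning

ι-* : ∀ a b → ι (a ℕ.* b) ≡ ι a * ι b
ι-* zero b = sym (ℚP.*-zeroˡ (ι b))
ι-* (suc a) b = begin
  ι (b +ℕ a ℕ.* b)      ≡⟨ ι-+ b (a ℕ.* b) ⟩
  ι b + ι (a ℕ.* b)     ≡⟨ cong (λ x → ι b + x) (ι-* a b) ⟩
  ι b + ι a * ι b       ≡⟨ normal (ι a) (ι b) ⟩
  (1ℚ + ι a) * ι b      ≡⟨ cong (_* ι b) (ι-suc a) ⟨
  ι (suc a) * ι b       ∎
  where
  open ≡-Reasoning
  normal : ∀ x y → y + x * y ≡ (1ℚ + x) * y
  normal = solve-∀ ℚ-ring

ι-^ : ∀ a n → ι (a ℕ.^ n) ≡ ι a ^ n
ι-^ a zero = refl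
ι-^ a (suc n) = trans (ι-* a (a ℕ.^ n)) (cong (ι a *_) (ι-^ a n))

ι-suc≢0 : ∀ n → ¬ (ι (suc n) ≡ 0ℚ)
ι-suc≢0 n eq with trans (sym (ι-normal (suc n))) eq
... | ()

*-^ : ∀ a b n → (a * b) ^ n ≡ a ^ n * b ^ n
*-^ a b zero = refl
*-^ a b (suc n) = trans (cong ((a * b) *_) (*-^ a b n)) (normal a b (a ^ n) (b ^ n))
  where
  normal : ∀ a b x y → a * b * (x * y) ≡ a * x * (b * y)
  normal = solve-∀ ℚ-ring

^-+ : ∀ a m n → a ^ (m +ℕ n) ≡ a ^ m * a ^ n
^-+ a zero n = sym (ℚP.*-identityˡ _)
^-+ a (suc m) n = trans (cong (a *_) (^-+ a m n)) (sym (ℚP.*-assoc a _ _))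

sign² : ∀ j → (- 1ℚ) ^ j * (- 1ℚ) ^ j ≡ 1ℚ
sign² zero = refl
sign² (suc j) = trans (normal ((- 1ℚ) ^ j)) (sign² j)
  where
  normal : ∀ x → (- 1ℚ) * x * ((- 1ℚ) * x) ≡ x * x
  normal = solve-∀ ℚ-ring

-- The total inverse q ↦ 1 ÷₀ q (with 0 ↦ 0).  Division ÷₀ is multiplication
-- by it, and it is multiplicative on all of ℚ, zero included.
inv : ℚ → ℚ
inv q = 1ℚ ÷₀ q

÷₀≡*inv : ∀ p q → p ÷₀ q ≡ p * inv q
÷₀≡*inv p q with q ℚP.≟ 0ℚ
... | yes _ = sym (ℚP.*-zeroʳ p)
... | no q≢0 = cong (p *_) (sym (ℚP.*-identityˡ ((1/ q) {{≢-nonZero q≢0}})))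

*-inv : ∀ q → ¬ (q ≡ 0ℚ) → q * inv q ≡ 1ℚ
*-inv q q≢0 with q ℚP.≟ 0ℚ
... | yes q≡0 = contradiction q≡0 q≢0
... | no q≢0' = trans (cong (q *_) (ℚP.*-identityˡ _)) (ℚP.*-inverseʳ q {{≢-nonZero q≢0'}})

*-cancelʳ : ∀ x y c → ¬ (c ≡ 0ℚ) → x * c ≡ y * c → x ≡ y
*-cancelʳ x y c c≢0 eq = begin
  x                   ≡⟨ ℚP.*-identityʳ x ⟨
  x * 1ℚ              ≡⟨ cong (x *_) (*-inv c c≢0) ⟨
  x * (c * inv c)     ≡⟨ ℚP.*-assoc x c (inv c) ⟨
  x * c * inv c       ≡⟨ cong (_* inv c) eq ⟩
  y * c * inv c       ≡⟨ ℚP.*-assoc y c (inv c) ⟩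
  y * (c * inv c)     ≡⟨ cong (y *_) (*-inv c c≢0) ⟩
  y * 1ℚ              ≡⟨ ℚP.*-identityʳ y ⟩
  y                   ∎
  where open ≡-Reasoning

inv-* : ∀ p q → inv (p * q) ≡ inv p * inv q
inv-* p q = byCases (p ℚP.≟ 0ℚ) (q ℚP.≟ 0ℚ)
  where
  open ≡-Reasoning
  normal : ∀ a b x y → a * x * (b * y) ≡ x * y * (a * b)
  normal = solve-∀ ℚ-ring
  byCases : Dec (p ≡ 0ℚ) → Dec (q ≡ 0ℚ) → inv (p * q) ≡ inv p * inv q
  byCases (yes refl) _ = trans (cong inv (ℚP.*-zeroˡ q)) (sym (ℚP.*-zeroˡ (inv q)))
  byCases (no _) (yes refl) = trans (cong inv (ℚP.*-zeroʳ p)) (sym (ℚP.*-zeroʳ (inv p)))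
  byCases (no p≢0) (no q≢0) = *-cancelʳ _ _ (p * q) pq≢0 (begin
      inv (p * q) * (p * q)       ≡⟨ ℚP.*-comm (inv (p * q)) (p * q) ⟩
      p * q * inv (p * q)         ≡⟨ *-inv (p * q) pq≢0 ⟩
      1ℚ                          ≡⟨ cong₂ _*_ (*-inv p p≢0) (*-inv q q≢0) ⟨
      p * inv p * (q * inv q)     ≡⟨ normal p q (inv p) (inv q) ⟩
      inv p * inv q * (p * q)     ∎)
    where
    pq≢0 : ¬ (p * q ≡ 0ℚ)
    pq≢0 pq≡0 = p≢0 (*-cancelʳ p 0ℚ q q≢0 (trans pq≡0 (sym (ℚP.*-zeroˡ q))))

inv-^ : ∀ p n → inv (p ^ n) ≡ inv p ^ n
inv-^ p zero = refl
inv-^ p (suc n) = trans (inv-* p (p ^ n)) (cong (inv p *_) (inv-^ p n))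

÷₀-^ : ∀ a b n → (a ÷₀ b) ^ n ≡ a ^ n ÷₀ b ^ n
÷₀-^ a b n = begin
  (a ÷₀ b) ^ n          ≡⟨ cong (_^ n) (÷₀≡*inv a b) ⟩
  (a * inv b) ^ n       ≡⟨ *-^ a (inv b) n ⟩
  a ^ n * inv b ^ n     ≡⟨ cong (a ^ n *_) (inv-^ b n) ⟨
  a ^ n * inv (b ^ n)   ≡⟨ ÷₀≡*inv (a ^ n) (b ^ n) ⟨
  a ^ n ÷₀ b ^ n        ∎
  where open ≡-Reasoning

/suc-* : ∀ z d → (z ℚ./ suc d) * ι (suc d) ≡ z ℚ./ 1
/suc-* z d = ℚP.toℚᵘ-injective (ℚᵘP.≃-trans (ℚP.toℚᵘ-homo-* (z ℚ./ suc d) (ι (suc d)))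
  (ℚᵘP.≃-trans (ℚᵘP.*-cong (ℚP.toℚᵘ-fromℚᵘ (ℚᵘ.mkℚᵘ z d)) (ι-toℚᵘ (suc d)))
  (ℚᵘP.≃-trans (ℚᵘ.*≡* (normal z (+ suc d))) (ℚᵘP.≃-sym (ℚP.toℚᵘ-fromℚᵘ (ℚᵘ.mkℚᵘ z 0))))))
  where
  normal : ∀ z x → z ℤ.* x ℤ.* + 1 ≡ z ℤ.* (x ℤ.* + 1)
  normal = ℤSolver.solve-∀

-/1 : ∀ n k → (+ n ℤ.- + k) ℚ./ 1 ≡ ι n - ι k
-/1 n k = ℚP.toℚᵘ-injective (ℚᵘP.≃-trans (ℚP.toℚᵘ-fromℚᵘ (ℚᵘ.mkℚᵘ (+ n ℤ.- + k) 0)) (ℚᵘP.≃-sym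
  (ℚᵘP.≃-trans (ℚP.toℚᵘ-homo-+ (ι n) (- ι k)) (ℚᵘP.≃-trans
    (ℚᵘP.+-cong (ι-toℚᵘ n) (ℚᵘP.≃-trans (ℚP.toℚᵘ-homo‿- (ι k)) (ℚᵘP.-‿cong (ι-toℚᵘ k))))
    (ℚᵘ.*≡* (normal (+ n) (+ k)))))))
  where
  normal : ∀ a b → (a ℤ.* + 1 ℤ.+ ℤ.- b ℤ.* + 1) ℤ.* + 1 ≡ (a ℤ.- b) ℤ.* (+ 1 ℤ.* + 1)
  normal = ℤSolver.solve-∀

+-+≡+∸ : ∀ m a → a ≤ m → + m ℤ.- + a ≡ + (m ∸ a)
+-+≡+∸ m a a≤m = trans (ℤP.m-n≡m⊖n m a) (ℤP.⊖-≥ a≤m)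

-- Binomial coefficients by Pascal's rule.  They agree with the library's
-- `_C_` (B≡C), but are defined by structural recursion, so induction on
-- them is immediate.
B : ℕ → ℕ → ℕ
B n zero = 1
B zero (suc k) = 0
B (suc n) (suc k) = B n k +ℕ B n (suc k)

B≡C : ∀ n k → B n k ≡ n C k
B≡C n zero = refl
B≡C zero (suc k) = refl
B≡C (suc n) (suc k) = trans (cong₂ _+ℕ_ (B≡C n k) (B≡C n (suc k))) (nCk+nC[k+1]≡[n+1]C[k+1] n k)

B-over : ∀ n k → n < k → B n k ≡ 0
B-over zero (suc k) _ = refl
B-over (suc n) (suc k) (s≤s n<k) = cong₂ _+ℕ_ (B-over n k n<k) (B-over n (suc k) (ℕP.m<n⇒m<1+n n<k))

B-diag : ∀ n → B n n ≡ 1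
B-diag zero = refl
B-diag (suc n) = cong₂ _+ℕ_ (B-diag n) (B-over n (suc n) ℕP.≤-refl)

B-one : ∀ n → B n 1 ≡ n
B-one zero = refl
B-one (suc n) = cong suc (B-one n)

-- Absorption:  (k+1) B(n,k+1) + k B(n,k) = n B(n,k),  i.e. the ratio
-- B(n,k+1)/B(n,k) = (n-k)/(k+1) of consecutive coefficients.
B-absorb : ∀ n k → suc k ℕ.* B n (suc k) +ℕ k ℕ.* B n k ≡ n ℕ.* B n k
B-absorb zero zero = refl
B-absorb zero (suc k) = cong₂ _+ℕ_ (ℕP.*-zeroʳ (suc (suc k))) (ℕP.*-zeroʳ (suc k))
B-absorb (suc n) zero = begin
  1 ℕ.* (B n 0 +ℕ B n 1) +ℕ 0   ≡⟨ normal (B n 1) ⟩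
  suc (B n 1)                    ≡⟨ cong suc (B-one n) ⟩
  suc n                          ≡⟨ ℕP.*-identityʳ (suc n) ⟨
  suc n ℕ.* 1                    ∎
  where
  open ≡-Reasoning
  normal : ∀ b → 1 ℕ.* (1 +ℕ b) +ℕ 0 ≡ suc b
  normal = ℕSolver.solve-∀
B-absorb (suc n) (suc k) = begin
  (2 +ℕ k) ℕ.* (b₁ +ℕ b₂) +ℕ (1 +ℕ k) ℕ.* (b₀ +ℕ b₁)
    ≡⟨ regroup₁ k b₀ b₁ b₂ ⟩
  (2 +ℕ k) ℕ.* b₁ +ℕ (1 +ℕ k) ℕ.* b₀ +ℕ ((2 +ℕ k) ℕ.* b₂ +ℕ (1 +ℕ k) ℕ.* b₁)
    ≡⟨ cong ((2 +ℕ k) ℕ.* b₁ +ℕ (1 +ℕ k) ℕ.* b₀ +ℕ_) (B-absorb n (suc k)) ⟩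
  (2 +ℕ k) ℕ.* b₁ +ℕ (1 +ℕ k) ℕ.* b₀ +ℕ n ℕ.* b₁
    ≡⟨ regroup₂ k n b₀ b₁ ⟩
  b₀ +ℕ b₁ +ℕ n ℕ.* b₁ +ℕ ((1 +ℕ k) ℕ.* b₁ +ℕ k ℕ.* b₀)
    ≡⟨ cong (b₀ +ℕ b₁ +ℕ n ℕ.* b₁ +ℕ_) (B-absorb n k) ⟩
  b₀ +ℕ b₁ +ℕ n ℕ.* b₁ +ℕ n ℕ.* b₀
    ≡⟨ regroup₃ n b₀ b₁ ⟩
  (1 +ℕ n) ℕ.* (b₀ +ℕ b₁) ∎
  where
  open ≡-Reasoning
  b₀ = B n k
  b₁ = B n (suc k)
  b₂ = B n (suc (suc k))
  regroup₁ : ∀ k b₀ b₁ b₂ → (2 +ℕ k) ℕ.* (b₁ +ℕ b₂) +ℕ (1 +ℕ k) ℕ.* (b₀ +ℕ b₁)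
           ≡ (2 +ℕ k) ℕ.* b₁ +ℕ (1 +ℕ k) ℕ.* b₀ +ℕ ((2 +ℕ k) ℕ.* b₂ +ℕ (1 +ℕ k) ℕ.* b₁)
  regroup₁ = ℕSolver.solve-∀
  regroup₂ : ∀ k n b₀ b₁ → (2 +ℕ k) ℕ.* b₁ +ℕ (1 +ℕ k) ℕ.* b₀ +ℕ n ℕ.* b₁
           ≡ b₀ +ℕ b₁ +ℕ n ℕ.* b₁ +ℕ ((1 +ℕ k) ℕ.* b₁ +ℕ k ℕ.* b₀)
  regroup₂ = ℕSolver.solve-∀
  regroup₃ : ∀ n b₀ b₁ → b₀ +ℕ b₁ +ℕ n ℕ.* b₁ +ℕ n ℕ.* b₀ ≡ (1 +ℕ n) ℕ.* (b₀ +ℕ b₁)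
  regroup₃ = ℕSolver.solve-∀

-- At non-negative integers the generalized binomial `binom` of Defs is the
-- ordinary one: the factor (n-k)/(k+1) in its recursion is absorption.
binom-ι : ∀ n k → binom (+ n) k ≡ ι (B n k)
binom-ι n zero = refl
binom-ι n (suc k) = begin
  binom (+ n) k * q   ≡⟨ cong (_* q) (binom-ι n k) ⟩
  ι b₀ * q            ≡⟨ *-cancelʳ (ι b₁) (ι b₀ * q) (ι (suc k)) (ι-suc≢0 k) cleared ⟨
  ι b₁                ∎
  where
  open ≡-Reasoning
  b₀ = B n k
  b₁ = B n (suc k)
  q = (+ n ℤ.- + k) ℚ./ suc k
  absorb : ι (suc k) * ι b₁ + ι k * ι b₀ ≡ ι n * ι b₀
  absorb = begin
    ι (suc k) * ι b₁ + ι k * ι b₀          ≡⟨ cong₂ _+_ (ι-* (suc k) b₁) (ι-* k b₀) ⟨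
    ι (suc k ℕ.* b₁) + ι (k ℕ.* b₀)        ≡⟨ ι-+ (suc k ℕ.* b₁) (k ℕ.* b₀) ⟨
    ι (suc k ℕ.* b₁ +ℕ k ℕ.* b₀)           ≡⟨ cong ι (B-absorb n k) ⟩
    ι (n ℕ.* b₀)                           ≡⟨ ι-* n b₀ ⟩
    ι n * ι b₀                             ∎
  normal₁ : ∀ x y z w → x * y ≡ (x * y + z * w) - z * w
  normal₁ = solve-∀ ℚ-ring
  normal₂ : ∀ n k b → n * b - k * b ≡ (n - k) * b
  normal₂ = solve-∀ ℚ-ring
  normal₃ : ∀ q s b → q * s * b ≡ b * q * s
  normal₃ = solve-∀ ℚ-ring
  cleared : ι b₁ * ι (suc k) ≡ ι b₀ * q * ι (suc k)
  cleared = begin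
    ι b₁ * ι (suc k)                                  ≡⟨ ℚP.*-comm (ι b₁) (ι (suc k)) ⟩
    ι (suc k) * ι b₁                                  ≡⟨ normal₁ (ι (suc k)) (ι b₁) (ι k) (ι b₀) ⟩
    (ι (suc k) * ι b₁ + ι k * ι b₀) - ι k * ι b₀      ≡⟨ cong (_- ι k * ι b₀) absorb ⟩
    ι n * ι b₀ - ι k * ι b₀                           ≡⟨ normal₂ (ι n) (ι k) (ι b₀) ⟩
    (ι n - ι k) * ι b₀                                ≡⟨ cong (_* ι b₀) (-/1 n k) ⟨
    ((+ n ℤ.- + k) ℚ./ 1) * ι b₀                      ≡⟨ cong (_* ι b₀) (/suc-* (+ n ℤ.- + k) k) ⟨
    q * ι (suc k) * ι b₀                              ≡⟨ normal₃ q (ι (suc k)) (ι b₀) ⟩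
    ι b₀ * q * ι (suc k)                              ∎

B-factorial : ∀ {n k} → k ≤ n → B n k ℕ.* (k ! ℕ.* (n ∸ k) !) ≡ n !
B-factorial {n} {k} k≤n =
  trans (cong (ℕ._* (k ! ℕ.* (n ∸ k) !)) (trans (B≡C n k) (nCk≡n!/k![n-k]! k≤n)))
        (m/n*n≡m (k![n∸k]!∣n! k≤n))
  where instance _ = ℕP._!*_!≢0 k (n ∸ k)

B-sym : ∀ {n k} → k ≤ n → B n (n ∸ k) ≡ B n k
B-sym {n} {k} k≤n = trans (B≡C n (n ∸ k)) (trans (sym (nCk≡nC[n∸k] k≤n)) (sym (B≡C n k)))

i+j≤m : ∀ {m i j} → i ≤ m → j ≤ m ∸ i → i +ℕ j ≤ m
i+j≤m {m} {i} {j} i≤m j≤m∸i = subst (_≤ m) (ℕP.+-comm j i) (ℕP.m≤o∸n⇒m+n≤o j i≤m j≤m∸i)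

-- Trinomial revision  B(m,i) B(m-i,j) = B(i+j,i) B(m,i+j):  both count the
-- ways to choose disjoint sets of sizes i and j from m elements.
-- In range, both sides times i! j! (m-i-j)! equal m! by B-factorial.
B-revision-inRange : ∀ {m i j} → i ≤ m → j ≤ m ∸ i → B m i ℕ.* B (m ∸ i) j ≡ B (i +ℕ j) i ℕ.* B m (i +ℕ j)
B-revision-inRange {m} {i} {j} i≤m j≤m∸i = ℕP.*-cancelʳ-≡ _ _ K {{K≢0}} (trans lhs (sym rhs))
  where
  open ≡-Reasoning
  r = m ∸ i ∸ j
  K = i ! ℕ.* (j ! ℕ.* r !)
  K≢0 : ℕ.NonZero K
  K≢0 = ℕP.m*n≢0 (i !) (j ! ℕ.* r !) {{ℕP._!≢0 i}} {{ℕP._!*_!≢0 j r}}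
  regroupˡ : ∀ x y p q r → x ℕ.* y ℕ.* (p ℕ.* (q ℕ.* r)) ≡ x ℕ.* (p ℕ.* (y ℕ.* (q ℕ.* r)))
  regroupˡ = ℕSolver.solve-∀
  regroupʳ : ∀ x y p q r → x ℕ.* y ℕ.* (p ℕ.* (q ℕ.* r)) ≡ y ℕ.* ((x ℕ.* (p ℕ.* q)) ℕ.* r)
  regroupʳ = ℕSolver.solve-∀
  lhs : B m i ℕ.* B (m ∸ i) j ℕ.* K ≡ m !
  lhs = begin
    B m i ℕ.* B (m ∸ i) j ℕ.* K                          ≡⟨ regroupˡ (B m i) (B (m ∸ i) j) (i !) (j !) (r !) ⟩
    B m i ℕ.* (i ! ℕ.* (B (m ∸ i) j ℕ.* (j ! ℕ.* r !)))  ≡⟨ cong (λ x → B m i ℕ.* (i ! ℕ.* x)) (B-factorial j≤m∸i) ⟩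
    B m i ℕ.* (i ! ℕ.* (m ∸ i) !)                        ≡⟨ B-factorial i≤m ⟩
    m ! ∎
  rhs : B (i +ℕ j) i ℕ.* B m (i +ℕ j) ℕ.* K ≡ m !
  rhs = begin
    B (i +ℕ j) i ℕ.* B m (i +ℕ j) ℕ.* K
      ≡⟨ regroupʳ (B (i +ℕ j) i) (B m (i +ℕ j)) (i !) (j !) (r !) ⟩
    B m (i +ℕ j) ℕ.* ((B (i +ℕ j) i ℕ.* (i ! ℕ.* j !)) ℕ.* r !)
      ≡⟨ cong (λ x → B m (i +ℕ j) ℕ.* ((B (i +ℕ j) i ℕ.* (i ! ℕ.* x !)) ℕ.* r !)) (ℕP.m+n∸m≡n i j) ⟨
    B m (i +ℕ j) ℕ.* ((B (i +ℕ j) i ℕ.* (i ! ℕ.* (i +ℕ j ∸ i) !)) ℕ.* r !)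
      ≡⟨ cong (λ x → B m (i +ℕ j) ℕ.* (x ℕ.* r !)) (B-factorial (ℕP.m≤m+n i j)) ⟩
    B m (i +ℕ j) ℕ.* ((i +ℕ j) ! ℕ.* r !)
      ≡⟨ cong (λ x → B m (i +ℕ j) ℕ.* ((i +ℕ j) ! ℕ.* x !)) (ℕP.∸-+-assoc m i j) ⟩
    B m (i +ℕ j) ℕ.* ((i +ℕ j) ! ℕ.* (m ∸ (i +ℕ j)) !)
      ≡⟨ B-factorial (i+j≤m i≤m j≤m∸i) ⟩
    m ! ∎

-- Out of range (i > m or i + j > m) both sides vanish.
B-revision : ∀ m i j → B m i ℕ.* B (m ∸ i) j ≡ B (i +ℕ j) i ℕ.* B m (i +ℕ j)
B-revision m i j with i ℕ.≤? m
... | no i≰m = trans (cong (ℕ._* B (m ∸ i) j) (B-over m i m<i))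
                     (sym (trans (cong (B (i +ℕ j) i ℕ.*_) (B-over m (i +ℕ j) m<i+j)) (ℕP.*-zeroʳ (B (i +ℕ j) i))))
  where
  m<i = ℕP.≰⇒> i≰m
  m<i+j = ℕP.<-≤-trans m<i (ℕP.m≤m+n i j)
... | yes i≤m with j ℕ.≤? (m ∸ i)
...   | no j≰ = trans (cong (B m i ℕ.*_) (B-over (m ∸ i) j (ℕP.≰⇒> j≰)))
                      (trans (ℕP.*-zeroʳ (B m i))
                             (sym (trans (cong (B (i +ℕ j) i ℕ.*_) (B-over m (i +ℕ j) m<i+j)) (ℕP.*-zeroʳ (B (i +ℕ j) i)))))
  where
  m<i+j : m < i +ℕ j
  m<i+j = subst (_< i +ℕ j) (ℕP.m+[n∸m]≡n i≤m) (ℕP.+-monoʳ-< i (ℕP.≰⇒> j≰))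
...   | yes j≤m∸i = B-revision-inRange i≤m j≤m∸i

Σ-cong : ∀ n {f g : ℕ → ℚ} → (∀ l → l ≤ n → f l ≡ g l) → Σ≤ n f ≡ Σ≤ n g
Σ-cong zero eq = eq 0 z≤n
Σ-cong (suc n) eq = cong₂ _+_ (Σ-cong n (λ l l≤n → eq l (ℕP.m≤n⇒m≤1+n l≤n))) (eq (suc n) ℕP.≤-refl)

Σ-zero : ∀ n (f : ℕ → ℚ) → (∀ l → l ≤ n → f l ≡ 0ℚ) → Σ≤ n f ≡ 0ℚ
Σ-zero n f eq = trans (Σ-cong n eq) (zeros n)
  where
  zeros : ∀ n → Σ≤ n (λ _ → 0ℚ) ≡ 0ℚ
  zeros zero = refl
  zeros (suc n) = cong (_+ 0ℚ) (zeros n)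

Σ-head : ∀ n (f : ℕ → ℚ) → Σ≤ (suc n) f ≡ f 0 + Σ≤ n (λ l → f (suc l))
Σ-head zero f = refl
Σ-head (suc n) f = trans (cong (_+ f (suc (suc n))) (Σ-head n f)) (ℚP.+-assoc (f 0) _ _)

Σ-+ : ∀ n (f g : ℕ → ℚ) → Σ≤ n (λ l → f l + g l) ≡ Σ≤ n f + Σ≤ n g
Σ-+ zero f g = refl
Σ-+ (suc n) f g = trans (cong (_+ (f (suc n) + g (suc n))) (Σ-+ n f g))
                        (normal (Σ≤ n f) (Σ≤ n g) (f (suc n)) (g (suc n)))
  where
  normal : ∀ a b c d → a + b + (c + d) ≡ a + c + (b + d)
  normal = solve-∀ ℚ-ring

Σ-*ˡ : ∀ n c (f : ℕ → ℚ) → Σ≤ n (λ l → c * f l) ≡ c * Σ≤ n f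
Σ-*ˡ zero c f = refl
Σ-*ˡ (suc n) c f = trans (cong (_+ c * f (suc n)) (Σ-*ˡ n c f)) (sym (ℚP.*-distribˡ-+ c (Σ≤ n f) (f (suc n))))

Σ-neg : ∀ n (f : ℕ → ℚ) → Σ≤ n (λ l → - f l) ≡ - Σ≤ n f
Σ-neg zero f = refl
Σ-neg (suc n) f = trans (cong (_+ - f (suc n)) (Σ-neg n f)) (sym (ℚP.neg-distrib-+ (Σ≤ n f) (f (suc n))))

Σ-reverse : ∀ n (f : ℕ → ℚ) → Σ≤ n f ≡ Σ≤ n (λ j → f (n ∸ j))
Σ-reverse zero f = refl
Σ-reverse (suc n) f = trans (cong (_+ f (suc n)) (Σ-reverse n f))
  (trans (ℚP.+-comm _ (f (suc n))) (sym (Σ-head n (λ j → f (suc n ∸ j)))))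

-- The alternating binomial transform  Σ_{l ≤ t} (-1)^l B(t,l) g(l).
-- Pascal's rule makes it obey  T_{t+1} g = T_t g − T_t (g ∘ suc),
-- the recursion of an iterated difference.
altBinom : ℕ → (ℕ → ℚ) → ℚ
altBinom t g = Σ≤ t (λ l → (- 1ℚ) ^ l * ι (B t l) * g l)

altBinom-cong : ∀ t {g h : ℕ → ℚ} → (∀ l → l ≤ t → g l ≡ h l) → altBinom t g ≡ altBinom t h
altBinom-cong t eq = Σ-cong t (λ l l≤t → cong ((- 1ℚ) ^ l * ι (B t l) *_) (eq l l≤t))

altBinom-suc : ∀ t g → altBinom (suc t) g ≡ altBinom t g - altBinom t (λ l → g (suc l))
altBinom-suc t g = begin
  Σ≤ (suc t) F                                    ≡⟨ Σ-head t F ⟩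
  F 0 + Σ≤ t (λ l → F (suc l))                    ≡⟨ cong (λ x → F 0 + x) (Σ-cong t (λ l _ → pascal l)) ⟩
  F 0 + Σ≤ t (λ l → - H l + G (suc l))            ≡⟨ cong (λ x → F 0 + x) (Σ-+ t (λ l → - H l) (λ l → G (suc l))) ⟩
  F 0 + (Σ≤ t (λ l → - H l) + Σ≤ t (λ l → G (suc l)))
                                                  ≡⟨ cong (λ x → F 0 + (x + Σ≤ t (λ l → G (suc l)))) (Σ-neg t H) ⟩
  F 0 + (- Σ≤ t H + Σ≤ t (λ l → G (suc l)))       ≡⟨ normal (F 0) (Σ≤ t H) (Σ≤ t (λ l → G (suc l))) ⟩
  (G 0 + Σ≤ t (λ l → G (suc l))) - Σ≤ t H         ≡⟨ cong (_- Σ≤ t H) (Σ-head t G) ⟨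
  (Σ≤ t G + G (suc t)) - Σ≤ t H                   ≡⟨ cong (λ x → (Σ≤ t G + x) - Σ≤ t H) G-last ⟩
  (Σ≤ t G + 0ℚ) - Σ≤ t H                          ≡⟨ cong (_- Σ≤ t H) (ℚP.+-identityʳ (Σ≤ t G)) ⟩
  Σ≤ t G - Σ≤ t H                                 ∎
  where
  open ≡-Reasoning
  F G H : ℕ → ℚ
  F l = (- 1ℚ) ^ l * ι (B (suc t) l) * g l
  G l = (- 1ℚ) ^ l * ι (B t l) * g l
  H l = (- 1ℚ) ^ l * ι (B t l) * g (suc l)
  normal : ∀ f h s → f + (- h + s) ≡ (f + s) - h
  normal = solve-∀ ℚ-ring
  G-last : G (suc t) ≡ 0ℚ
  G-last = trans (cong (λ b → (- 1ℚ) ^ suc t * ι b * g (suc t)) (B-over t (suc t) ℕP.≤-refl)) (zeroes ((- 1ℚ) ^ suc t) (g (suc t)))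
    where
    zeroes : ∀ x y → x * 0ℚ * y ≡ 0ℚ
    zeroes = solve-∀ ℚ-ring
  pascal : ∀ l → F (suc l) ≡ - H l + G (suc l)
  pascal l = trans (cong (λ x → (- 1ℚ) * (- 1ℚ) ^ l * x * g (suc l)) (ι-+ (B t l) (B t (suc l))))
                   (expand ((- 1ℚ) ^ l) (ι (B t l)) (ι (B t (suc l))) (g (suc l)))
    where
    expand : ∀ x b b' w → (- 1ℚ) * x * (b + b') * w ≡ - (x * b * w) + (- 1ℚ) * x * b' * w
    expand = solve-∀ ℚ-ring

iterated-difference : (a : ℕ → ℕ → ℚ) → (∀ t p → a (suc t) p ≡ a t p - a t (suc p)) →
                      ∀ t p → a t p ≡ altBinom t (λ l → a 0 (p +ℕ l))
iterated-difference a step zero p = trans (cong (a 0) (sym (ℕP.+-identityʳ p))) (normal (a 0 (p +ℕ 0)))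
  where
  normal : ∀ x → x ≡ 1ℚ * 1ℚ * x
  normal = solve-∀ ℚ-ring
iterated-difference a step (suc t) p = begin
  a (suc t) p                                                       ≡⟨ step t p ⟩
  a t p - a t (suc p)                                               ≡⟨ cong₂ _-_ (iterated-difference a step t p)
                                                                                 (iterated-difference a step t (suc p)) ⟩
  altBinom t (λ l → a 0 (p +ℕ l)) - altBinom t (λ l → a 0 (suc p +ℕ l))
    ≡⟨ cong (λ x → altBinom t (λ l → a 0 (p +ℕ l)) - x) (altBinom-cong t (λ l _ → cong (a 0) (sym (ℕP.+-suc p l)))) ⟩
  altBinom t (λ l → a 0 (p +ℕ l)) - altBinom t (λ l → a 0 (p +ℕ suc l)) ≡⟨ altBinom-suc t (λ l → a 0 (p +ℕ l)) ⟨
  altBinom (suc t) (λ l → a 0 (p +ℕ l))                             ∎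
  where open ≡-Reasoning

∇^-expansion : ∀ (f : ℤ → ℚ) t x → ∇^ t f x ≡ altBinom t (λ l → f (x ℤ.- + l))
∇^-expansion f t x = begin
  ∇^ t f x                                ≡⟨ cong (∇^ t f) (ℤP.+-identityʳ x) ⟨
  a t 0                                   ≡⟨ iterated-difference a step t 0 ⟩
  altBinom t (λ l → f (x ℤ.- + l))        ∎
  where
  open ≡-Reasoning
  a : ℕ → ℕ → ℚ
  a t p = ∇^ t f (x ℤ.- + p)
  shift : ∀ x y → x ℤ.- y ℤ.- + 1 ≡ x ℤ.- (+ 1 ℤ.+ y)
  shift = ℤSolver.solve-∀
  step : ∀ t p → a (suc t) p ≡ a t p - a t (suc p)
  step t p = cong (λ y → a t p - ∇^ t f y) (shift x (+ p))

∇^-cong : ∀ {f g : ℤ → ℚ} → (∀ x → f x ≡ g x) → ∀ t x → ∇^ t f x ≡ ∇^ t g x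
∇^-cong eq zero x = eq x
∇^-cong eq (suc t) x = cong₂ _-_ (∇^-cong eq t x) (∇^-cong eq t (x ℤ.- + 1))

∇^-scale : ∀ {f g : ℤ → ℚ} (κ : ℚ) → (∀ x → f x ≡ g x * κ) → ∀ t x → ∇^ t f x ≡ ∇^ t g x * κ
∇^-scale κ eq zero x = eq x
∇^-scale {g = g} κ eq (suc t) x =
  trans (cong₂ _-_ (∇^-scale κ eq t x) (∇^-scale κ eq t (x ℤ.- + 1)))
        (normal (∇^ t g x) (∇^ t g (x ℤ.- + 1)) κ)
  where
  normal : ∀ a b k → a * k - b * k ≡ (a - b) * k
  normal = solve-∀ ℚ-ring

-- The signed array (-1)^t Δ^t g(p) obeys the difference recursion; the
-- sum is then reversed (j = s - l) using the symmetry of B.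
Δ^-expansion : ∀ (g : ℕ → ℚ) s → Δ^ s g 0 ≡ Σ≤ s (λ j → (- 1ℚ) ^ j * ι (B s j) * g (s ∸ j))
Δ^-expansion g s = begin
  Δ^ s g 0                                  ≡⟨ unsign ⟨
  (- 1ℚ) ^ s * a s 0                        ≡⟨ cong ((- 1ℚ) ^ s *_) (iterated-difference a step s 0) ⟩
  (- 1ℚ) ^ s * altBinom s (λ l → 1ℚ * g l)  ≡⟨ Σ-*ˡ s ((- 1ℚ) ^ s) _ ⟨
  Σ≤ s (λ l → (- 1ℚ) ^ s * term l)          ≡⟨ Σ-reverse s _ ⟩
  Σ≤ s (λ j → (- 1ℚ) ^ s * term (s ∸ j))    ≡⟨ Σ-cong s reflected ⟩
  Σ≤ s (λ j → (- 1ℚ) ^ j * ι (B s j) * g (s ∸ j)) ∎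
  where
  open ≡-Reasoning
  a : ℕ → ℕ → ℚ
  a t p = (- 1ℚ) ^ t * Δ^ t g p
  term : ℕ → ℚ
  term l = (- 1ℚ) ^ l * ι (B s l) * (1ℚ * g l)
  flip : ∀ x u v → (- 1ℚ) * x * (v - u) ≡ x * u - x * v
  flip = solve-∀ ℚ-ring
  step : ∀ t p → a (suc t) p ≡ a t p - a t (suc p)
  step t p = flip ((- 1ℚ) ^ t) (Δ^ t g p) (Δ^ t g (suc p))
  unsign : (- 1ℚ) ^ s * a s 0 ≡ Δ^ s g 0
  unsign = trans (sym (ℚP.*-assoc ((- 1ℚ) ^ s) ((- 1ℚ) ^ s) (Δ^ s g 0)))
                 (trans (cong (_* Δ^ s g 0) (sign² s)) (ℚP.*-identityˡ (Δ^ s g 0)))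
  normal : ∀ a x c d → a * x * (x * c * (1ℚ * d)) ≡ (x * x) * (a * c * d)
  normal = solve-∀ ℚ-ring
  reflected : ∀ j → j ≤ s → (- 1ℚ) ^ s * term (s ∸ j) ≡ (- 1ℚ) ^ j * ι (B s j) * g (s ∸ j)
  reflected j j≤s = begin
    (- 1ℚ) ^ s * ((- 1ℚ) ^ (s ∸ j) * ι (B s (s ∸ j)) * (1ℚ * g (s ∸ j)))
      ≡⟨ cong₂ (λ x y → (- 1ℚ) ^ x * ((- 1ℚ) ^ (s ∸ j) * ι y * (1ℚ * g (s ∸ j))))
               (sym (ℕP.m+[n∸m]≡n j≤s)) (B-sym j≤s) ⟩
    (- 1ℚ) ^ (j +ℕ (s ∸ j)) * ((- 1ℚ) ^ (s ∸ j) * ι (B s j) * (1ℚ * g (s ∸ j)))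
      ≡⟨ cong (_* ((- 1ℚ) ^ (s ∸ j) * ι (B s j) * (1ℚ * g (s ∸ j)))) (^-+ (- 1ℚ) j (s ∸ j)) ⟩
    (- 1ℚ) ^ j * (- 1ℚ) ^ (s ∸ j) * ((- 1ℚ) ^ (s ∸ j) * ι (B s j) * (1ℚ * g (s ∸ j)))
      ≡⟨ normal ((- 1ℚ) ^ j) ((- 1ℚ) ^ (s ∸ j)) (ι (B s j)) (g (s ∸ j)) ⟩
    ((- 1ℚ) ^ (s ∸ j) * (- 1ℚ) ^ (s ∸ j)) * ((- 1ℚ) ^ j * ι (B s j) * g (s ∸ j))
      ≡⟨ cong (_* ((- 1ℚ) ^ j * ι (B s j) * g (s ∸ j))) (sign² (s ∸ j)) ⟩
    1ℚ * ((- 1ℚ) ^ j * ι (B s j) * g (s ∸ j))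
      ≡⟨ ℚP.*-identityˡ _ ⟩
    (- 1ℚ) ^ j * ι (B s j) * g (s ∸ j) ∎

alternating-row-sum : ∀ a N → Σ≤ N (λ j → (- 1ℚ) ^ j * ι (B (suc a) j)) ≡ (- 1ℚ) ^ N * ι (B a N)
alternating-row-sum a zero = refl
alternating-row-sum a (suc N) = begin
  Σ≤ N (λ j → (- 1ℚ) ^ j * ι (B (suc a) j)) + (- 1ℚ) ^ suc N * ι (B a N +ℕ B a (suc N))
    ≡⟨ cong₂ (λ x y → x + (- 1ℚ) ^ suc N * y) (alternating-row-sum a N) (ι-+ (B a N) (B a (suc N))) ⟩
  (- 1ℚ) ^ N * ι (B a N) + (- 1ℚ) * (- 1ℚ) ^ N * (ι (B a N) + ι (B a (suc N)))
    ≡⟨ telescope ((- 1ℚ) ^ N) (ι (B a N)) (ι (B a (suc N))) ⟩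
  (- 1ℚ) ^ suc N * ι (B a (suc N)) ∎
  where
  open ≡-Reasoning
  telescope : ∀ x b b' → x * b + (- 1ℚ) * x * (b + b') ≡ (- 1ℚ) * x * b'
  telescope = solve-∀ ℚ-ring

δ : ℕ → ℕ → ℕ
δ x i = if does (x ℕ.≟ i) then 1 else 0

alternating-row-sum-full : ∀ a N → a ≤ N → Σ≤ N (λ j → (- 1ℚ) ^ j * ι (B a j)) ≡ ι (δ a 0)
alternating-row-sum-full zero zero _ = refl
alternating-row-sum-full zero (suc N) _ =
  trans (cong (_+ (- 1ℚ) ^ suc N * 0ℚ) (alternating-row-sum-full zero N z≤n)) (vanish ((- 1ℚ) ^ suc N))
  where
  vanish : ∀ x → 1ℚ + x * 0ℚ ≡ 1ℚ
  vanish = solve-∀ ℚ-ring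
alternating-row-sum-full (suc a) N a<N =
  trans (alternating-row-sum a N) (trans (cong (λ b → (- 1ℚ) ^ N * ι b) (B-over a N a<N)) (ℚP.*-zeroʳ ((- 1ℚ) ^ N)))

-- The kernel of binomial inversion: for X ≤ M,
--   Σ_{j ≤ M-i} (-1)^j B(i+j,i) B(X,i+j) = δ(X,i).
-- By trinomial revision the sum is B(X,i) times an alternating row sum
-- of row X-i.
inversion-kernel : ∀ X i M → X ≤ M →
  Σ≤ (M ∸ i) (λ j → (- 1ℚ) ^ j * ι (B (i +ℕ j) i) * ι (B X (i +ℕ j))) ≡ ι (δ X i)
inversion-kernel X i M X≤M = begin
  Σ≤ (M ∸ i) (λ j → (- 1ℚ) ^ j * ι (B (i +ℕ j) i) * ι (B X (i +ℕ j)))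
    ≡⟨ Σ-cong (M ∸ i) (λ j _ → revised j) ⟩
  Σ≤ (M ∸ i) (λ j → ι (B X i) * ((- 1ℚ) ^ j * ι (B (X ∸ i) j)))
    ≡⟨ Σ-*ˡ (M ∸ i) (ι (B X i)) (λ j → (- 1ℚ) ^ j * ι (B (X ∸ i) j)) ⟩
  ι (B X i) * Σ≤ (M ∸ i) (λ j → (- 1ℚ) ^ j * ι (B (X ∸ i) j))
    ≡⟨ byCases (ℕP.<-cmp X i) ⟩
  ι (δ X i) ∎
  where
  open ≡-Reasoning
  swap : ∀ a b c → a * (b * c) ≡ b * (a * c)
  swap = solve-∀ ℚ-ring
  revised : ∀ j → (- 1ℚ) ^ j * ι (B (i +ℕ j) i) * ι (B X (i +ℕ j)) ≡ ι (B X i) * ((- 1ℚ) ^ j * ι (B (X ∸ i) j))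
  revised j = begin
    (- 1ℚ) ^ j * ι (B (i +ℕ j) i) * ι (B X (i +ℕ j))    ≡⟨ ℚP.*-assoc ((- 1ℚ) ^ j) _ _ ⟩
    (- 1ℚ) ^ j * (ι (B (i +ℕ j) i) * ι (B X (i +ℕ j)))  ≡⟨ cong ((- 1ℚ) ^ j *_) (ι-* (B (i +ℕ j) i) (B X (i +ℕ j))) ⟨
    (- 1ℚ) ^ j * ι (B (i +ℕ j) i ℕ.* B X (i +ℕ j))      ≡⟨ cong (λ x → (- 1ℚ) ^ j * ι x) (B-revision X i j) ⟨
    (- 1ℚ) ^ j * ι (B X i ℕ.* B (X ∸ i) j)              ≡⟨ cong ((- 1ℚ) ^ j *_) (ι-* (B X i) (B (X ∸ i) j)) ⟩
    (- 1ℚ) ^ j * (ι (B X i) * ι (B (X ∸ i) j))          ≡⟨ swap ((- 1ℚ) ^ j) (ι (B X i)) (ι (B (X ∸ i) j)) ⟩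
    ι (B X i) * ((- 1ℚ) ^ j * ι (B (X ∸ i) j))          ∎
  S = Σ≤ (M ∸ i) (λ j → (- 1ℚ) ^ j * ι (B (X ∸ i) j))
  δ-off : ¬ (X ≡ i) → ι (δ X i) ≡ 0ℚ
  δ-off X≢i = cong (λ b → ι (if b then 1 else 0)) (dec-false (X ℕ.≟ i) X≢i)
  byCases : Tri (X < i) (X ≡ i) (i < X) →
            ι (B X i) * Σ≤ (M ∸ i) (λ j → (- 1ℚ) ^ j * ι (B (X ∸ i) j)) ≡ ι (δ X i)
  byCases (tri< X<i X≢i _) =
    trans (cong (λ b → ι b * S) (B-over X i X<i)) (trans (ℚP.*-zeroˡ S) (sym (δ-off X≢i)))
  byCases (tri≈ _ refl _) = begin
    ι (B X X) * Σ≤ (M ∸ X) (λ j → (- 1ℚ) ^ j * ι (B (X ∸ X) j))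
      ≡⟨ cong₂ _*_ (cong ι (B-diag X)) (alternating-row-sum-full (X ∸ X) (M ∸ X) (ℕP.∸-monoˡ-≤ X X≤M)) ⟩
    1ℚ * ι (δ (X ∸ X) 0)    ≡⟨ ℚP.*-identityˡ _ ⟩
    ι (δ (X ∸ X) 0)         ≡⟨ cong (λ x → ι (δ x 0)) (ℕP.n∸n≡0 X) ⟩
    ι 1                     ≡⟨ cong (λ b → ι (if b then 1 else 0)) (dec-true (X ℕ.≟ X) refl) ⟨
    ι (δ X X)               ∎
  byCases (tri> _ X≢i i<X) = begin
    ι (B X i) * Σ≤ (M ∸ i) (λ j → (- 1ℚ) ^ j * ι (B (X ∸ i) j))
      ≡⟨ cong (ι (B X i) *_) (alternating-row-sum-full (X ∸ i) (M ∸ i) (ℕP.∸-monoˡ-≤ i X≤M)) ⟩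
    ι (B X i) * ι (δ (X ∸ i) 0)
      ≡⟨ cong (λ b → ι (B X i) * ι (if b then 1 else 0)) (dec-false (X ∸ i ℕ.≟ 0) (ℕP.m>n⇒m∸n≢0 i<X)) ⟩
    ι (B X i) * 0ℚ          ≡⟨ ℚP.*-zeroʳ (ι (B X i)) ⟩
    0ℚ                      ≡⟨ δ-off X≢i ⟨
    ι (δ X i)               ∎

ΣL : {A : Set} → List A → (A → ℕ) → ℕ
ΣL [] f = 0
ΣL (x ∷ xs) f = f x +ℕ ΣL xs f

ΣL-cong : {A : Set} (xs : List A) {f g : A → ℕ} → (∀ x → f x ≡ g x) → ΣL xs f ≡ ΣL xs g
ΣL-cong [] eq = refl
ΣL-cong (x ∷ xs) eq = cong₂ _+ℕ_ (eq x) (ΣL-cong xs eq)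

ΣL-++ : {A : Set} (xs ys : List A) (f : A → ℕ) → ΣL (xs ++ ys) f ≡ ΣL xs f +ℕ ΣL ys f
ΣL-++ [] ys f = refl
ΣL-++ (x ∷ xs) ys f = trans (cong (f x +ℕ_) (ΣL-++ xs ys f)) (sym (ℕP.+-assoc (f x) _ _))

ΣL-concatMap : {A A' : Set} (g : A → List A') (xs : List A) (f : A' → ℕ) →
               ΣL (concatMap g xs) f ≡ ΣL xs (λ x → ΣL (g x) f)
ΣL-concatMap g [] f = refl
ΣL-concatMap g (x ∷ xs) f = trans (ΣL-++ (g x) (concatMap g xs) f) (cong (ΣL (g x) f +ℕ_) (ΣL-concatMap g xs f))

ΣL-map : {A A' : Set} (h : A → A') (xs : List A) (f : A' → ℕ) → ΣL (map h xs) f ≡ ΣL xs (λ x → f (h x))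
ΣL-map h [] f = refl
ΣL-map h (x ∷ xs) f = cong (f (h x) +ℕ_) (ΣL-map h xs f)

ΣL-filter : {A : Set} {P : A → Set} (P? : ∀ x → Dec (P x)) (xs : List A) (f : A → ℕ) →
            ΣL (filter P? xs) f ≡ ΣL xs (λ x → if does (P? x) then f x else 0)
ΣL-filter P? [] f = refl
ΣL-filter P? (x ∷ xs) f with does (P? x)
... | true = cong (f x +ℕ_) (ΣL-filter P? xs f)
... | false = ΣL-filter P? xs f

length≡ΣL : {A : Set} (xs : List A) → length xs ≡ ΣL xs (λ _ → 1)
length≡ΣL [] = refl
length≡ΣL (x ∷ xs) = cong suc (length≡ΣL xs)

ΣL-+ : {A : Set} (xs : List A) (f g : A → ℕ) → ΣL xs (λ x → f x +ℕ g x) ≡ ΣL xs f +ℕ ΣL xs g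
ΣL-+ [] f g = refl
ΣL-+ (x ∷ xs) f g = trans (cong (f x +ℕ g x +ℕ_) (ΣL-+ xs f g)) (regroup (f x) (g x) (ΣL xs f) (ΣL xs g))
  where
  regroup : ∀ a b c d → a +ℕ b +ℕ (c +ℕ d) ≡ a +ℕ c +ℕ (b +ℕ d)
  regroup = ℕSolver.solve-∀

ΣL-*ˡ : {A : Set} (xs : List A) (c : ℕ) (f : A → ℕ) → ΣL xs (λ x → c ℕ.* f x) ≡ c ℕ.* ΣL xs f
ΣL-*ˡ [] c f = sym (ℕP.*-zeroʳ c)
ΣL-*ˡ (x ∷ xs) c f = trans (cong (c ℕ.* f x +ℕ_) (ΣL-*ˡ xs c f)) (sym (ℕP.*-distribˡ-+ c (f x) (ΣL xs f)))

ΣL-*ʳ : {A : Set} (xs : List A) (c : ℕ) (f : A → ℕ) → ΣL xs (λ x → f x ℕ.* c) ≡ ΣL xs f ℕ.* c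
ΣL-*ʳ xs c f = trans (ΣL-cong xs (λ x → ℕP.*-comm (f x) c)) (trans (ΣL-*ˡ xs c f) (ℕP.*-comm c (ΣL xs f)))

ΣL-zero : {A : Set} (xs : List A) → ΣL xs (λ _ → 0) ≡ 0
ΣL-zero [] = refl
ΣL-zero (x ∷ xs) = ΣL-zero xs

ΣL-swap : {A A' : Set} (xs : List A) (ys : List A') (f : A → A' → ℕ) →
          ΣL xs (λ x → ΣL ys (f x)) ≡ ΣL ys (λ y → ΣL xs (λ x → f x y))
ΣL-swap [] ys f = sym (ΣL-zero ys)
ΣL-swap (x ∷ xs) ys f = trans (cong (ΣL ys (f x) +ℕ_) (ΣL-swap xs ys f)) (sym (ΣL-+ ys (f x) (λ y → ΣL xs (λ x' → f x' y))))

ΣL-if : {A : Set} (xs : List A) (b : Bool) (f : A → ℕ) → ΣL xs (λ x → if b then f x else 0) ≡ (if b then ΣL xs f else 0)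
ΣL-if xs true f = refl
ΣL-if xs false f = ΣL-zero xs

ΣL-allSubsets : ∀ m (f : Subset (suc m) → ℕ) →
                ΣL (allSubsets (suc m)) f ≡ ΣL (allSubsets m) (λ s → f (inside ∷ s) +ℕ f (outside ∷ s))
ΣL-allSubsets m f = trans (ΣL-concatMap _ (allSubsets m) f)
                          (ΣL-cong (allSubsets m) (λ s → cong (f (inside ∷ s) +ℕ_) (ℕP.+-identityʳ _)))

∏ℕ : (c : ℕ) → (Fin c → ℕ) → ℕ
∏ℕ zero f = 1
∏ℕ (suc c) f = f zero ℕ.* ∏ℕ c (λ d → f (suc d))

∏V : {A : Set} {n : ℕ} → Vec A n → (A → ℕ) → ℕ
∏V [] f = 1
∏V (x ∷ v) f = f x ℕ.* ∏V v f

ΣL-tuples : {A : Set} (xs : List A) (n : ℕ) (f : A → ℕ) → ΣL (tuples xs n) (λ v → ∏V v f) ≡ ΣL xs f ℕ.^ n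
ΣL-tuples xs zero f = refl
ΣL-tuples xs (suc n) f = begin
  ΣL (concatMap (λ x → map (x ∷_) (tuples xs n)) xs) (λ v → ∏V v f)
    ≡⟨ ΣL-concatMap (λ x → map (x ∷_) (tuples xs n)) xs (λ v → ∏V v f) ⟩
  ΣL xs (λ x → ΣL (map (x ∷_) (tuples xs n)) (λ v → ∏V v f))
    ≡⟨ ΣL-cong xs (λ x → trans (ΣL-map (x ∷_) (tuples xs n) (λ v → ∏V v f))
                        (trans (ΣL-*ˡ (tuples xs n) (f x) (λ v → ∏V v f)) (cong (f x ℕ.*_) (ΣL-tuples xs n f)))) ⟩
  ΣL xs (λ x → f x ℕ.* ΣL xs f ℕ.^ n)
    ≡⟨ ΣL-*ʳ xs (ΣL xs f ℕ.^ n) f ⟩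
  ΣL xs f ℕ.* ΣL xs f ℕ.^ n ∎
  where open ≡-Reasoning

ΣL-depFuns : (c : ℕ) {A : Fin c → Set} (E : (d : Fin c) → List (A d)) (f : (d : Fin c) → A d → ℕ) →
             ΣL (depFuns c E) (λ ω → ∏ℕ c (λ d → f d (ω d))) ≡ ∏ℕ c (λ d → ΣL (E d) (f d))
ΣL-depFuns zero E f = refl
ΣL-depFuns (suc c) {A} E f = begin
  ΣL (depFuns (suc c) E) F
    ≡⟨ ΣL-concatMap _ (E zero) F ⟩
  ΣL (E zero) (λ a → ΣL (map _ rest) F)
    ≡⟨ ΣL-cong (E zero) (λ a → trans (ΣL-map _ rest F)
                          (trans (ΣL-*ˡ rest (f zero a) _) (cong (f zero a ℕ.*_) (ΣL-depFuns c (λ d → E (suc d)) (λ d → f (suc d)))))) ⟩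
  ΣL (E zero) (λ a → f zero a ℕ.* R)
    ≡⟨ ΣL-*ʳ (E zero) R (f zero) ⟩
  ΣL (E zero) (f zero) ℕ.* R ∎
  where
  open ≡-Reasoning
  rest = depFuns c (λ d → E (suc d))
  F = λ (ω : (d : Fin (suc c)) → A d) → ∏ℕ (suc c) (λ d → f d (ω d))
  R = ∏ℕ c (λ d → ΣL (E (suc d)) (f (suc d)))

ι-ΣL : {A : Set} (xs : List A) (f : A → ℕ) → List.foldr _+_ 0ℚ (map (λ x → ι (f x)) xs) ≡ ι (ΣL xs f)
ι-ΣL [] f = refl
ι-ΣL (x ∷ xs) f = trans (cong (λ y → ι (f x) + y) (ι-ΣL xs f)) (sym (ι-+ (f x) (ΣL xs f)))

ι-∏ : ∀ c (f : Fin c → ℕ) → ι (∏ℕ c f) ≡ ∏ c (λ d → ι (f d))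
ι-∏ zero f = refl
ι-∏ (suc c) f = trans (ι-* (f zero) _) (cong (ι (f zero) *_) (ι-∏ c (λ d → f (suc d))))

ι-ΣL-const : {A : Set} (xs : List A) (p : A → Bool) (P : A → ℕ) (v : ℚ) → (∀ x → p x ≡ true → ι (P x) ≡ v) →
             ι (ΣL xs (λ x → if p x then P x else 0)) ≡ ι (ΣL xs (λ x → if p x then 1 else 0)) * v
ι-ΣL-const [] p P v eq = sym (ℚP.*-zeroˡ v)
ι-ΣL-const (x ∷ xs) p P v eq with p x in px
... | true = begin
    ι (P x +ℕ R)          ≡⟨ ι-+ (P x) R ⟩
    ι (P x) + ι R         ≡⟨ cong₂ _+_ (eq x px) (ι-ΣL-const xs p P v eq) ⟩
    v + ι R₁ * v          ≡⟨ normal v (ι R₁) ⟩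
    (1ℚ + ι R₁) * v       ≡⟨ cong (_* v) (ι-suc R₁) ⟨
    ι (suc R₁) * v        ∎
  where
  open ≡-Reasoning
  R = ΣL xs (λ x → if p x then P x else 0)
  R₁ = ΣL xs (λ x → if p x then 1 else 0)
  normal : ∀ v r → v + r * v ≡ (1ℚ + r) * v
  normal = solve-∀ ℚ-ring
... | false = ι-ΣL-const xs p P v eq

∏-cong : ∀ c {f g : Fin c → ℚ} → (∀ d → f d ≡ g d) → ∏ c f ≡ ∏ c g
∏-cong zero eq = refl
∏-cong (suc c) eq = cong₂ _*_ (eq zero) (∏-cong c (λ d → eq (suc d)))

∏-* : ∀ c (f g : Fin c → ℚ) → ∏ c (λ d → f d * g d) ≡ ∏ c f * ∏ c g
∏-* zero f g = refl
∏-* (suc c) f g = trans (cong (f zero * g zero *_) (∏-* c (λ d → f (suc d)) (λ d → g (suc d))))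
                        (normal (f zero) (g zero) _ _)
  where
  normal : ∀ a b x y → a * b * (x * y) ≡ a * x * (b * y)
  normal = solve-∀ ℚ-ring

inv-∏ : ∀ c (f : Fin c → ℚ) → inv (∏ c f) ≡ ∏ c (λ d → inv (f d))
inv-∏ zero f = refl
inv-∏ (suc c) f = trans (inv-* (f zero) _) (cong (inv (f zero) *_) (inv-∏ c (λ d → f (suc d))))

-- A pattern prescribes, for each element of [m], that a set must contain
-- it, must avoid it, or is free there.  Inclusion–exclusion is carried out
-- by rewriting patterns: "free" = "must" + "avoid".
data Mark : Set where
  free must avoid : Mark

allows : Mark → Bool → Bool
allows free b = true
allows must b = b
allows avoid b = not b

Pattern : ℕ → Set
Pattern m = Vec Mark m

matches : ∀ {m} → Pattern m → Subset m → Bool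
matches [] [] = true
matches (μ ∷ π) (u ∷ U) = allows μ u ∧ matches π U

#must : ∀ {m} → Pattern m → ℕ
#must [] = 0
#must (free ∷ π) = #must π
#must (must ∷ π) = suc (#must π)
#must (avoid ∷ π) = #must π

#avoid : ∀ {m} → Pattern m → ℕ
#avoid [] = 0
#avoid (free ∷ π) = #avoid π
#avoid (must ∷ π) = #avoid π
#avoid (avoid ∷ π) = suc (#avoid π)

#avoid≤ : ∀ {m} (π : Pattern m) → #avoid π ≤ m
#avoid≤ [] = z≤n
#avoid≤ (free ∷ π) = ℕP.m≤n⇒m≤1+n (#avoid≤ π)
#avoid≤ (must ∷ π) = ℕP.m≤n⇒m≤1+n (#avoid≤ π)
#avoid≤ (avoid ∷ π) = s≤s (#avoid≤ π)

⟦_⟧ : Bool → ℕ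
⟦ true ⟧ = 1
⟦ false ⟧ = 0

⟦∧⟧ : ∀ a b → ⟦ a ∧ b ⟧ ≡ ⟦ a ⟧ ℕ.* ⟦ b ⟧
⟦∧⟧ true b = sym (ℕP.+-identityʳ ⟦ b ⟧)
⟦∧⟧ false b = refl

matches-∪ : ∀ {m} (π : Pattern m) → #must π ≡ 0 → (U V : Subset m) →
            matches π (U ∪ V) ≡ matches π U ∧ matches π V
matches-∪ [] _ [] [] = refl
matches-∪ (free ∷ π) no-must (u ∷ U) (v ∷ V) = matches-∪ π no-must U V
matches-∪ (avoid ∷ π) no-must (true ∷ U) (v ∷ V) = refl
matches-∪ (avoid ∷ π) no-must (false ∷ U) (v ∷ V) =
  trans (cong (not v ∧_) (matches-∪ π no-must U V)) (interchange true (not v) (matches π U) (matches π V))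

matches-∩ : ∀ {m} (π : Pattern m) → #avoid π ≡ 0 → (U V : Subset m) →
            matches π (U ∩ V) ≡ matches π U ∧ matches π V
matches-∩ [] _ [] [] = refl
matches-∩ (free ∷ π) no-avoid (u ∷ U) (v ∷ V) = matches-∩ π no-avoid U V
matches-∩ (must ∷ π) no-avoid (u ∷ U) (v ∷ V) =
  trans (cong ((u ∧ v) ∧_) (matches-∩ π no-avoid U V)) (interchange u v (matches π U) (matches π V))

matches-⊥ : ∀ {m} (π : Pattern m) → #must π ≡ 0 → matches π ⊥ ≡ true
matches-⊥ [] _ = refl
matches-⊥ (free ∷ π) no-must = matches-⊥ π no-must
matches-⊥ (avoid ∷ π) no-must = matches-⊥ π no-must

matches-⊤ : ∀ {m} (π : Pattern m) → #avoid π ≡ 0 → matches π ⊤ ≡ true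
matches-⊤ [] _ = refl
matches-⊤ (free ∷ π) no-avoid = matches-⊤ π no-avoid
matches-⊤ (must ∷ π) no-avoid = matches-⊤ π no-avoid

matches-⋃ : ∀ {m n} (π : Pattern m) → #must π ≡ 0 → (v : Vec (Subset m) n) →
            ⟦ matches π (⋃ (Vec.toList v)) ⟧ ≡ ∏V v (λ s → ⟦ matches π s ⟧)
matches-⋃ π no-must [] = cong ⟦_⟧ (matches-⊥ π no-must)
matches-⋃ π no-must (s ∷ v) =
  trans (cong ⟦_⟧ (matches-∪ π no-must s (⋃ (Vec.toList v))))
        (trans (⟦∧⟧ (matches π s) _) (cong (⟦ matches π s ⟧ ℕ.*_) (matches-⋃ π no-must v)))

matches-⋂ : ∀ {m} (π : Pattern m) → #avoid π ≡ 0 → (c : ℕ) (U : Fin c → Subset m) →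
            ⟦ matches π (⋂ (List.tabulate U)) ⟧ ≡ ∏ℕ c (λ d → ⟦ matches π (U d) ⟧)
matches-⋂ π no-avoid zero U = cong ⟦_⟧ (matches-⊤ π no-avoid)
matches-⋂ π no-avoid (suc c) U =
  trans (cong ⟦_⟧ (matches-∩ π no-avoid (U zero) _))
        (trans (⟦∧⟧ (matches π (U zero)) _) (cong (⟦ matches π (U zero) ⟧ ℕ.*_) (matches-⋂ π no-avoid c (λ d → U (suc d)))))

relaxFirst : ∀ {m} → Pattern m → Pattern m
relaxFirst [] = []
relaxFirst (free ∷ π) = free ∷ relaxFirst π
relaxFirst (must ∷ π) = free ∷ π
relaxFirst (avoid ∷ π) = avoid ∷ relaxFirst π

forbidFirst : ∀ {m} → Pattern m → Pattern m
forbidFirst [] = []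
forbidFirst (free ∷ π) = free ∷ forbidFirst π
forbidFirst (must ∷ π) = avoid ∷ π
forbidFirst (avoid ∷ π) = avoid ∷ forbidFirst π

matches-split : ∀ {m} t (π : Pattern m) → #must π ≡ suc t → (U : Subset m) →
                ⟦ matches (relaxFirst π) U ⟧ ≡ ⟦ matches π U ⟧ +ℕ ⟦ matches (forbidFirst π) U ⟧
matches-split t (free ∷ π) e (u ∷ U) = matches-split t π e U
matches-split t (avoid ∷ π) e (true ∷ U) = refl
matches-split t (avoid ∷ π) e (false ∷ U) = matches-split t π e U
matches-split t (must ∷ π) e (true ∷ U) = sym (ℕP.+-identityʳ _)
matches-split t (must ∷ π) e (false ∷ U) = refl

#must-relaxFirst : ∀ {m} t (π : Pattern m) → #must π ≡ suc t → #must (relaxFirst π) ≡ t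
#must-relaxFirst t (free ∷ π) e = #must-relaxFirst t π e
#must-relaxFirst t (avoid ∷ π) e = #must-relaxFirst t π e
#must-relaxFirst t (must ∷ π) e = ℕP.suc-injective e

#must-forbidFirst : ∀ {m} t (π : Pattern m) → #must π ≡ suc t → #must (forbidFirst π) ≡ t
#must-forbidFirst t (free ∷ π) e = #must-forbidFirst t π e
#must-forbidFirst t (avoid ∷ π) e = #must-forbidFirst t π e
#must-forbidFirst t (must ∷ π) e = ℕP.suc-injective e

#avoid-relaxFirst : ∀ {m} t (π : Pattern m) → #must π ≡ suc t → #avoid (relaxFirst π) ≡ #avoid π
#avoid-relaxFirst t (free ∷ π) e = #avoid-relaxFirst t π e
#avoid-relaxFirst t (avoid ∷ π) e = cong suc (#avoid-relaxFirst t π e)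
#avoid-relaxFirst t (must ∷ π) e = refl

#avoid-forbidFirst : ∀ {m} t (π : Pattern m) → #must π ≡ suc t → #avoid (forbidFirst π) ≡ suc (#avoid π)
#avoid-forbidFirst t (free ∷ π) e = #avoid-forbidFirst t π e
#avoid-forbidFirst t (avoid ∷ π) e = cong suc (#avoid-forbidFirst t π e)
#avoid-forbidFirst t (must ∷ π) e = refl

-- Restricting a weight to the subsets of size k: sums over k-subsets are
-- written as sums over all subsets, as `committees` is a filter.
sized : ∀ {m} → ℕ → (Subset m → ℕ) → Subset m → ℕ
sized k f s = if does (∣ s ∣ ℕ.≟ k) then f s else 0

-- An element put in the set raises its size, so among the sets containing
-- an avoided element the size test contributes nothing either way.
if-0 : ∀ b → (if b then 0 else 0) ≡ 0
if-0 true = refl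
if-0 false = refl

count-avoiding : ∀ m (π : Pattern m) k → #must π ≡ 0 →
                 ΣL (allSubsets m) (sized k (λ s → ⟦ matches π s ⟧)) ≡ B (m ∸ #avoid π) k
count-avoiding zero [] zero _ = refl
count-avoiding zero [] (suc k) _ = refl
count-avoiding (suc m) (free ∷ π) zero no-must = trans (ΣL-allSubsets m _) (count-avoiding m π zero no-must)
count-avoiding (suc m) (free ∷ π) (suc k) no-must =
  trans (ΣL-allSubsets m _)
        (trans (ΣL-+ (allSubsets m) _ _)
               (trans (cong₂ _+ℕ_ (count-avoiding m π k no-must) (count-avoiding m π (suc k) no-must))
                      (cong (λ x → B x (suc k)) (sym (ℕP.+-∸-assoc 1 (#avoid≤ π))))))
count-avoiding (suc m) (avoid ∷ π) k no-must =
  trans (ΣL-allSubsets m _)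
        (trans (ΣL-cong (allSubsets m) (λ s → cong (_+ℕ sized k (λ s → ⟦ matches π s ⟧) s) (if-0 (does (suc ∣ s ∣ ℕ.≟ k)))))
               (count-avoiding m π k no-must))

mustOn : ∀ {m} → Subset m → Pattern m
mustOn [] = []
mustOn (true ∷ T) = must ∷ mustOn T
mustOn (false ∷ T) = free ∷ mustOn T

#must-mustOn : ∀ {m} (T : Subset m) → #must (mustOn T) ≡ ∣ T ∣
#must-mustOn [] = refl
#must-mustOn (true ∷ T) = cong suc (#must-mustOn T)
#must-mustOn (false ∷ T) = #must-mustOn T

#avoid-mustOn : ∀ {m} (T : Subset m) → #avoid (mustOn T) ≡ 0
#avoid-mustOn [] = refl
#avoid-mustOn (true ∷ T) = #avoid-mustOn T
#avoid-mustOn (false ∷ T) = #avoid-mustOn T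

subsets-of : ∀ m (S : Subset m) r → ΣL (allSubsets m) (sized r (λ T → ⟦ matches (mustOn T) S ⟧)) ≡ B ∣ S ∣ r
subsets-of zero [] zero = refl
subsets-of zero [] (suc r) = refl
subsets-of (suc m) (true ∷ S) zero = trans (ΣL-allSubsets m _) (subsets-of m S zero)
subsets-of (suc m) (true ∷ S) (suc r) =
  trans (ΣL-allSubsets m _) (trans (ΣL-+ (allSubsets m) _ _) (cong₂ _+ℕ_ (subsets-of m S r) (subsets-of m S (suc r))))
subsets-of (suc m) (false ∷ S) r =
  trans (ΣL-allSubsets m _)
        (trans (ΣL-cong (allSubsets m) (λ T → cong (_+ℕ sized r (λ T → ⟦ matches (mustOn T) S ⟧) T) (if-0 (does (suc ∣ T ∣ ℕ.≟ r)))))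
               (subsets-of m S r))

tupleCount : (m k n : ℕ) → Pattern m → ℕ
tupleCount m k n π = ΣL (tuples (committees m k) n) (λ v → ⟦ matches π (⋃ (Vec.toList v)) ⟧)

-- x ↦ binom(x,k)^n: the number of n-tuples of k-subsets of an x-set.
binomPower : ℕ → ℕ → ℤ → ℚ
binomPower k n x = binom x k ^ n

-- Without "must" marks, the union avoids the avoided elements iff every
-- member does, so the count is B(m - #avoid, k)^n.
tupleCount-avoiding : ∀ m k n (π : Pattern m) → #must π ≡ 0 →
                      ι (tupleCount m k n π) ≡ binomPower k n (+ m ℤ.- + #avoid π)
tupleCount-avoiding m k n π no-must = begin
  ι (tupleCount m k n π)
    ≡⟨ cong ι (ΣL-cong (tuples (committees m k) n) (matches-⋃ π no-must)) ⟩
  ι (ΣL (tuples (committees m k) n) (λ v → ∏V v (λ s → ⟦ matches π s ⟧)))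
    ≡⟨ cong ι (ΣL-tuples (committees m k) n _) ⟩
  ι (ΣL (committees m k) (λ s → ⟦ matches π s ⟧) ℕ.^ n)
    ≡⟨ cong (λ x → ι (x ℕ.^ n)) (trans (ΣL-filter (λ s → ∣ s ∣ ℕ.≟ k) (allSubsets m) _) (count-avoiding m π k no-must)) ⟩
  ι (B (m ∸ #avoid π) k ℕ.^ n)
    ≡⟨ ι-^ _ n ⟩
  ι (B (m ∸ #avoid π) k) ^ n
    ≡⟨ cong (_^ n) (binom-ι (m ∸ #avoid π) k) ⟨
  binom (+ (m ∸ #avoid π)) k ^ n
    ≡⟨ cong (λ x → binom x k ^ n) (+-+≡+∸ m (#avoid π) (#avoid≤ π)) ⟨
  binom (+ m ℤ.- + #avoid π) k ^ n ∎
  where open ≡-Reasoning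

-- Inclusion–exclusion: each "must" mark contributes one backward difference,
--   #{tuples whose union matches π} = ∇^{#must π} binomPower (m - #avoid π).
tupleCount-∇ : ∀ m k n t (π : Pattern m) → #must π ≡ t →
               ι (tupleCount m k n π) ≡ ∇^ t (binomPower k n) (+ m ℤ.- + #avoid π)
tupleCount-∇ m k n zero π no-must = tupleCount-avoiding m k n π no-must
tupleCount-∇ m k n (suc t) π #must≡ = begin
  ι (count π)                                        ≡⟨ isolate (ι (count π)) (ι (count (forbidFirst π))) ⟩
  (ι (count π) + ι (count (forbidFirst π))) - ι (count (forbidFirst π))
                                                     ≡⟨ cong (_- ι (count (forbidFirst π))) (ι-+ (count π) _) ⟨
  ι (count π +ℕ count (forbidFirst π)) - ι (count (forbidFirst π))
                                                     ≡⟨ cong (λ x → ι x - ι (count (forbidFirst π))) split ⟨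
  ι (count (relaxFirst π)) - ι (count (forbidFirst π))
    ≡⟨ cong₂ _-_ (tupleCount-∇ m k n t (relaxFirst π) (#must-relaxFirst t π #must≡))
                 (tupleCount-∇ m k n t (forbidFirst π) (#must-forbidFirst t π #must≡)) ⟩
  ∇^ t G (+ m ℤ.- + #avoid (relaxFirst π)) - ∇^ t G (+ m ℤ.- + #avoid (forbidFirst π))
    ≡⟨ cong₂ (λ a b → ∇^ t G (+ m ℤ.- + a) - ∇^ t G (+ m ℤ.- + b))
             (#avoid-relaxFirst t π #must≡) (#avoid-forbidFirst t π #must≡) ⟩
  ∇^ t G (+ m ℤ.- + #avoid π) - ∇^ t G (+ m ℤ.- + suc (#avoid π))
    ≡⟨ cong (λ x → ∇^ t G (+ m ℤ.- + #avoid π) - ∇^ t G x) (shift (+ m) (+ #avoid π)) ⟨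
  ∇^ (suc t) G (+ m ℤ.- + #avoid π) ∎
  where
  open ≡-Reasoning
  count = tupleCount m k n
  G = binomPower k n
  isolate : ∀ x y → x ≡ (x + y) - y
  isolate = solve-∀ ℚ-ring
  shift : ∀ a b → a ℤ.- b ℤ.- + 1 ≡ a ℤ.- (+ 1 ℤ.+ b)
  shift = ℤSolver.solve-∀
  split : count (relaxFirst π) ≡ count π +ℕ count (forbidFirst π)
  split = trans (ΣL-cong (tuples (committees m k) n) (λ v → matches-split t π #must≡ (⋃ (Vec.toList v))))
                (ΣL-+ (tuples (committees m k) n) _ _)

tupleCount-containing : ∀ m k n (T : Subset m) → ι (tupleCount m k n (mustOn T)) ≡ ∇^ ∣ T ∣ (binomPower k n) (+ m)
tupleCount-containing m k n T =
  trans (tupleCount-∇ m k n ∣ T ∣ (mustOn T) (#must-mustOn T))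
        (cong (∇^ ∣ T ∣ (binomPower k n)) (trans (cong (λ a → + m ℤ.- + a) (#avoid-mustOn T)) (ℤP.+-identityʳ (+ m))))

inversion-over : {A : Set} (X : A → ℕ) (i M : ℕ) → (∀ x → X x ≤ M) → (xs : List A) →
  Σ≤ (M ∸ i) (λ j → (- 1ℚ) ^ j * ι (B (i +ℕ j) i) * ι (ΣL xs (λ ω → B (X ω) (i +ℕ j)))) ≡ ι (ΣL xs (λ ω → δ (X ω) i))
inversion-over X i M X≤M [] = Σ-zero (M ∸ i) _ (λ j _ → ℚP.*-zeroʳ ((- 1ℚ) ^ j * ι (B (i +ℕ j) i)))
inversion-over X i M X≤M (x ∷ xs) = begin
  Σ≤ (M ∸ i) (λ j → a j * ι (B (X x) (i +ℕ j) +ℕ rest j))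
    ≡⟨ Σ-cong (M ∸ i) (λ j _ → trans (cong (a j *_) (ι-+ (B (X x) (i +ℕ j)) (rest j))) (ℚP.*-distribˡ-+ (a j) _ _)) ⟩
  Σ≤ (M ∸ i) (λ j → a j * ι (B (X x) (i +ℕ j)) + a j * ι (rest j))
    ≡⟨ Σ-+ (M ∸ i) _ _ ⟩
  Σ≤ (M ∸ i) (λ j → a j * ι (B (X x) (i +ℕ j))) + Σ≤ (M ∸ i) (λ j → a j * ι (rest j))
    ≡⟨ cong₂ _+_ (inversion-kernel (X x) i M (X≤M x)) (inversion-over X i M X≤M xs) ⟩
  ι (δ (X x) i) + ι (ΣL xs (λ ω → δ (X ω) i))
    ≡⟨ ι-+ (δ (X x) i) _ ⟨
  ι (δ (X x) i +ℕ ΣL xs (λ ω → δ (X ω) i)) ∎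
  where
  open ≡-Reasoning
  a : ℕ → ℚ
  a j = (- 1ℚ) ^ j * ι (B (i +ℕ j) i)
  rest : ℕ → ℕ
  rest j = ΣL xs (λ ω → B (X ω) (i +ℕ j))

module CommitteeModel (m c : ℕ) (n k : Fin c → ℕ) where

  outs : List (Outcome m c n)
  outs = outcomes m c n k

  N : ℕ
  N = length outs

  covered : Outcome m c n → Subset m
  covered ω = ⋂ (List.tabulate (λ d → ⋃ (Vec.toList (ω d))))

  outcomes-covering : ∀ T → ΣL outs (λ ω → ⟦ matches (mustOn T) (covered ω) ⟧)
                          ≡ ∏ℕ c (λ d → tupleCount m (k d) (n d) (mustOn T))
  outcomes-covering T =
    trans (ΣL-cong outs (λ ω → matches-⋂ (mustOn T) (#avoid-mustOn T) c (λ d → ⋃ (Vec.toList (ω d)))))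
          (ΣL-depFuns c (λ d → tuples (committees m (k d)) (n d)) (λ d v → ⟦ matches (mustOn T) (⋃ (Vec.toList v)) ⟧))

  V : ℕ → ℚ
  V r = ∏ c (λ d → ∇^ r (binomPower (k d) (n d)) (+ m))

  -- Double counting pairs (ω, T) with T ⊆ covered ω and |T| = r:
  --   Σ_ω B(X_∩ ω, r) = B(m, r) · V r.
  sum-of-binomials : ∀ r → ι (ΣL outs (λ ω → B (Xcap ω) r)) ≡ ι (B m r) * V r
  sum-of-binomials r = begin
    ι (ΣL outs (λ ω → B (Xcap ω) r))
      ≡⟨ cong ι (ΣL-cong outs (λ ω → subsets-of m (covered ω) r)) ⟨
    ι (ΣL outs (λ ω → ΣL (allSubsets m) (sized r (λ T → ⟦ matches (mustOn T) (covered ω) ⟧))))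
      ≡⟨ cong ι (ΣL-swap outs (allSubsets m) _) ⟩
    ι (ΣL (allSubsets m) (λ T → ΣL outs (λ ω → sized r (λ T → ⟦ matches (mustOn T) (covered ω) ⟧) T)))
      ≡⟨ cong ι (ΣL-cong (allSubsets m) per-T) ⟩
    ι (ΣL (allSubsets m) (sized r (λ T → ∏ℕ c (λ d → tupleCount m (k d) (n d) (mustOn T)))))
      ≡⟨ ι-ΣL-const (allSubsets m) (λ T → does (∣ T ∣ ℕ.≟ r)) _ (V r) count-of-size-r ⟩
    ι (ΣL (allSubsets m) (sized r (λ _ → 1))) * V r
      ≡⟨ cong (λ x → ι x * V r) r-subsets ⟩
    ι (B m r) * V r ∎
    where
    open ≡-Reasoning
    per-T : ∀ T → ΣL outs (λ ω → sized r (λ T → ⟦ matches (mustOn T) (covered ω) ⟧) T)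
                ≡ sized r (λ T → ∏ℕ c (λ d → tupleCount m (k d) (n d) (mustOn T))) T
    per-T T = trans (ΣL-if outs (does (∣ T ∣ ℕ.≟ r)) _)
                    (cong (λ x → if does (∣ T ∣ ℕ.≟ r) then x else 0) (outcomes-covering T))
    count-of-size-r : ∀ T → does (∣ T ∣ ℕ.≟ r) ≡ true → ι (∏ℕ c (λ d → tupleCount m (k d) (n d) (mustOn T))) ≡ V r
    count-of-size-r T size-r = trans (ι-∏ c _) (∏-cong c (λ d →
      trans (tupleCount-containing m (k d) (n d) T)
            (cong (λ t → ∇^ t (binomPower (k d) (n d)) (+ m)) (ℕP.≡ᵇ⇒≡ ∣ T ∣ r (subst Bool.T (sym size-r) _)))))
    r-subsets : ΣL (allSubsets m) (sized r (λ _ → 1)) ≡ B m r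
    r-subsets = trans (ΣL-cong (allSubsets m) (λ T → cong (λ x → sized r (λ _ → x) T) (cong ⟦_⟧ (sym (matches-⊤ (mustOn T) (#avoid-mustOn T))))))
                      (trans (subsets-of m ⊤ r) (cong (λ x → B x r) (∣⊤∣≡n m)))

  F : Fin c → ℤ → ℚ
  F d x = (binom x (k d) ÷₀ ι (m C k d)) ^ n d

  moment : ℕ → ℚ
  moment r = ∏ c (λ d → ∇^ r (F d) (+ m))

  -- The sample space has ∏_d B(m,k_d)^{n_d} points (the case r = 0 above).
  ι-N : ι N ≡ ∏ c (λ d → ι (m C k d) ^ n d)
  ι-N = begin
    ι N                                  ≡⟨ cong ι (length≡ΣL outs) ⟩
    ι (ΣL outs (λ ω → B (Xcap ω) 0))     ≡⟨ sum-of-binomials 0 ⟩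
    1ℚ * V 0                             ≡⟨ ℚP.*-identityˡ (V 0) ⟩
    ∏ c (λ d → binom (+ m) (k d) ^ n d)  ≡⟨ ∏-cong c (λ d → cong (_^ n d) (trans (binom-ι m (k d)) (cong ι (B≡C m (k d))))) ⟩
    ∏ c (λ d → ι (m C k d) ^ n d)        ∎
    where open ≡-Reasoning

  -- Normalising department d by its number of tuples is the scalar factor
  -- κ d, and these factors multiply to 1/N.
  moment≡V/N : ∀ r → moment r ≡ V r * inv (ι N)
  moment≡V/N r = begin
    moment r                                               ≡⟨ ∏-cong c (λ d → ∇^-scale (κ d) (scaled d) r (+ m)) ⟩
    ∏ c (λ d → ∇^ r (binomPower (k d) (n d)) (+ m) * κ d)  ≡⟨ ∏-* c _ κ ⟩
    V r * ∏ c κ                                            ≡⟨ cong (V r *_) inv-N ⟨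
    V r * inv (ι N)                                        ∎
    where
    open ≡-Reasoning
    κ : Fin c → ℚ
    κ d = inv (ι (m C k d)) ^ n d
    scaled : ∀ d x → F d x ≡ binomPower (k d) (n d) x * κ d
    scaled d x = trans (cong (_^ n d) (÷₀≡*inv (binom x (k d)) (ι (m C k d)))) (*-^ (binom x (k d)) _ (n d))
    inv-N : inv (ι N) ≡ ∏ c κ
    inv-N = trans (cong inv ι-N) (trans (inv-∏ c _) (∏-cong c (λ d → inv-^ (ι (m C k d)) (n d))))

  mean-of-binomials : ∀ r → ι (ΣL outs (λ ω → B (Xcap ω) r)) * inv (ι N) ≡ ι (B m r) * moment r
  mean-of-binomials r =
    trans (cong (_* inv (ι N)) (sum-of-binomials r))
          (trans (ℚP.*-assoc (ι (B m r)) (V r) (inv (ι N))) (cong (ι (B m r) *_) (sym (moment≡V/N r))))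

  binomial-moment : ∀ r → expBinomX m c n k r ≡ ι (m C r) * moment r
  binomial-moment r = begin
    List.foldr _+_ 0ℚ (List.map (λ ω → ι (Xcap ω C r)) outs) ÷₀ ι N
      ≡⟨ ÷₀≡*inv _ (ι N) ⟩
    List.foldr _+_ 0ℚ (List.map (λ ω → ι (Xcap ω C r)) outs) * inv (ι N)
      ≡⟨ cong (_* inv (ι N)) (trans (ι-ΣL outs (λ ω → Xcap ω C r)) (cong ι (ΣL-cong outs (λ ω → sym (B≡C (Xcap ω) r))))) ⟩
    ι (ΣL outs (λ ω → B (Xcap ω) r)) * inv (ι N)
      ≡⟨ mean-of-binomials r ⟩
    ι (B m r) * moment r
      ≡⟨ cong (λ x → ι x * moment r) (B≡C m r) ⟩
    ι (m C r) * moment r ∎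
    where open ≡-Reasoning

  probability-from-moments : ∀ i → probX m c n k i
    ≡ ι (m C i) * Σ≤ (m ∸ i) (λ j → (- 1ℚ) ^ j * ι ((m ∸ i) C j) * moment (i +ℕ j))
  probability-from-moments i = begin
    ι (length (filter (λ ω → Xcap ω ℕ.≟ i) outs)) ÷₀ ι N
      ≡⟨ ÷₀≡*inv _ (ι N) ⟩
    ι (length (filter (λ ω → Xcap ω ℕ.≟ i) outs)) * inv (ι N)
      ≡⟨ cong (λ x → ι x * inv (ι N)) (trans (length≡ΣL (filter (λ ω → Xcap ω ℕ.≟ i) outs)) (ΣL-filter (λ ω → Xcap ω ℕ.≟ i) outs (λ _ → 1))) ⟩
    ι (ΣL outs (λ ω → δ (Xcap ω) i)) * inv (ι N)
      ≡⟨ cong (_* inv (ι N)) (inversion-over Xcap i m (λ ω → ∣p∣≤n (covered ω)) outs) ⟨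
    Σ≤ (m ∸ i) (λ j → a j * count j) * inv (ι N)
      ≡⟨ ℚP.*-comm _ (inv (ι N)) ⟩
    inv (ι N) * Σ≤ (m ∸ i) (λ j → a j * count j)
      ≡⟨ Σ-*ˡ (m ∸ i) (inv (ι N)) _ ⟨
    Σ≤ (m ∸ i) (λ j → inv (ι N) * (a j * count j))
      ≡⟨ Σ-cong (m ∸ i) (λ j _ → per-term j) ⟩
    Σ≤ (m ∸ i) (λ j → ι (m C i) * ((- 1ℚ) ^ j * ι ((m ∸ i) C j) * moment (i +ℕ j)))
      ≡⟨ Σ-*ˡ (m ∸ i) (ι (m C i)) _ ⟩
    ι (m C i) * Σ≤ (m ∸ i) (λ j → (- 1ℚ) ^ j * ι ((m ∸ i) C j) * moment (i +ℕ j)) ∎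
    where
    open ≡-Reasoning
    a : ℕ → ℚ
    a j = (- 1ℚ) ^ j * ι (B (i +ℕ j) i)
    count : ℕ → ℚ
    count j = ι (ΣL outs (λ ω → B (Xcap ω) (i +ℕ j)))
    regroup₁ : ∀ z s b x → z * (s * b * x) ≡ s * b * (x * z)
    regroup₁ = solve-∀ ℚ-ring
    regroup₂ : ∀ s b b' μ → s * b * (b' * μ) ≡ s * (b * b') * μ
    regroup₂ = solve-∀ ℚ-ring
    regroup₃ : ∀ s x y μ → s * (x * y) * μ ≡ x * (s * y * μ)
    regroup₃ = solve-∀ ℚ-ring
    per-term : ∀ j → inv (ι N) * (a j * count j) ≡ ι (m C i) * ((- 1ℚ) ^ j * ι ((m ∸ i) C j) * moment (i +ℕ j))
    per-term j = begin
      inv (ι N) * (a j * count j)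
        ≡⟨ regroup₁ (inv (ι N)) ((- 1ℚ) ^ j) (ι (B (i +ℕ j) i)) (count j) ⟩
      a j * (count j * inv (ι N))
        ≡⟨ cong (a j *_) (mean-of-binomials (i +ℕ j)) ⟩
      (- 1ℚ) ^ j * ι (B (i +ℕ j) i) * (ι (B m (i +ℕ j)) * moment (i +ℕ j))
        ≡⟨ regroup₂ ((- 1ℚ) ^ j) (ι (B (i +ℕ j) i)) (ι (B m (i +ℕ j))) (moment (i +ℕ j)) ⟩
      (- 1ℚ) ^ j * (ι (B (i +ℕ j) i) * ι (B m (i +ℕ j))) * moment (i +ℕ j)
        ≡⟨ cong (λ x → (- 1ℚ) ^ j * x * moment (i +ℕ j)) (ι-* (B (i +ℕ j) i) (B m (i +ℕ j))) ⟨
      (- 1ℚ) ^ j * ι (B (i +ℕ j) i ℕ.* B m (i +ℕ j)) * moment (i +ℕ j)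
        ≡⟨ cong (λ x → (- 1ℚ) ^ j * ι x * moment (i +ℕ j)) (B-revision m i j) ⟨
      (- 1ℚ) ^ j * ι (B m i ℕ.* B (m ∸ i) j) * moment (i +ℕ j)
        ≡⟨ cong (λ x → (- 1ℚ) ^ j * x * moment (i +ℕ j))
                (trans (ι-* (B m i) (B (m ∸ i) j)) (cong₂ (λ x y → ι x * ι y) (B≡C m i) (B≡C (m ∸ i) j))) ⟩
      (- 1ℚ) ^ j * (ι (m C i) * ι ((m ∸ i) C j)) * moment (i +ℕ j)
        ≡⟨ regroup₃ ((- 1ℚ) ^ j) (ι (m C i)) (ι ((m ∸ i) C j)) (moment (i +ℕ j)) ⟩
      ι (m C i) * ((- 1ℚ) ^ j * ι ((m ∸ i) C j) * moment (i +ℕ j)) ∎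

  moment-expanded : ∀ t → t ≤ m → moment t
    ≡ ∏ c (λ d → Σ≤ t (λ l → (- 1ℚ) ^ l * ι (t C l) * ((ι ((m ∸ l) C k d) ÷₀ ι (m C k d)) ^ n d)))
  moment-expanded t t≤m = ∏-cong c (λ d → trans (∇^-expansion (F d) t (+ m)) (Σ-cong t (term d)))
    where
    term : ∀ d l → l ≤ t → (- 1ℚ) ^ l * ι (B t l) * F d (+ m ℤ.- + l)
                         ≡ (- 1ℚ) ^ l * ι (t C l) * ((ι ((m ∸ l) C k d) ÷₀ ι (m C k d)) ^ n d)
    term d l l≤t = cong₂ (λ x y → (- 1ℚ) ^ l * ι x * y) (B≡C t l)
      (cong (λ z → (z ÷₀ ι (m C k d)) ^ n d)
            (trans (cong (λ x → binom x (k d)) (+-+≡+∸ m l (ℕP.≤-trans l≤t t≤m)))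
                   (trans (binom-ι (m ∸ l) (k d)) (cong ι (B≡C (m ∸ l) (k d))))))

  probability-as-sums : ∀ i → i ≤ m → probX m c n k i
    ≡ ι (m C i) * Σ≤ (m ∸ i) (λ j → ((- 1ℚ) ^ j) * ι ((m ∸ i) C j)
        * ∏ c (λ d → Σ≤ (i +ℕ j) (λ l → ((- 1ℚ) ^ l) * ι ((i +ℕ j) C l)
            * ((ι ((m ∸ l) C k d) ÷₀ ι (m C k d)) ^ n d))))
  probability-as-sums i i≤m = trans (probability-from-moments i) (cong (ι (m C i) *_) (Σ-cong (m ∸ i) (λ j j≤m∸i →
    cong ((- 1ℚ) ^ j * ι ((m ∸ i) C j) *_) (moment-expanded (i +ℕ j) (i+j≤m i≤m j≤m∸i)))))

  -- The first formula of the theorem: the outer sum is a forward difference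
  -- Δ^{m-i} at 0 of y ↦ moment(m - y).
  probability-as-differences : ∀ i → i ≤ m → probX m c n k i
    ≡ ι (m C i) * Δ^ (m ∸ i)
        (λ y → ∏ c (λ d → ∇^ (m ∸ y) (λ x → binom x (k d) ^ n d ÷₀ (ι (m C k d) ^ n d)) (+ m))) 0
  probability-as-differences i i≤m =
    trans (probability-from-moments i) (cong (ι (m C i) *_) (sym (trans (Δ^-expansion g (m ∸ i)) (Σ-cong (m ∸ i) term))))
    where
    g : ℕ → ℚ
    g y = ∏ c (λ d → ∇^ (m ∸ y) (λ x → binom x (k d) ^ n d ÷₀ (ι (m C k d) ^ n d)) (+ m))
    g≡moment : ∀ y → g y ≡ moment (m ∸ y)
    g≡moment y = ∏-cong c (λ d → ∇^-cong (λ x → sym (÷₀-^ (binom x (k d)) (ι (m C k d)) (n d))) (m ∸ y) (+ m))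
    term : ∀ j → j ≤ m ∸ i → (- 1ℚ) ^ j * ι (B (m ∸ i) j) * g (m ∸ i ∸ j) ≡ (- 1ℚ) ^ j * ι ((m ∸ i) C j) * moment (i +ℕ j)
    term j j≤m∸i = cong₂ (λ x y → (- 1ℚ) ^ j * ι x * y) (B≡C (m ∸ i) j)
      (trans (g≡moment (m ∸ i ∸ j))
             (cong moment (trans (cong (m ∸_) (ℕP.∸-+-assoc m i j)) (ℕP.m∸[m∸n]≡n (i+j≤m i≤m j≤m∸i)))))

theorem2p12 : (m c : ℕ) → 1 ≤ m → 1 ≤ c → (n k : Fin c → ℕ) → (∀ d → k d ≤ m) →
  ((i : ℕ) → i ≤ m →
    (probX m c n k i
      ≡ ι (m C i) * Δ^ (m ∸ i)
          (λ y → ∏ c (λ d → ∇^ (m ∸ y) (λ x → binom x (k d) ^ n d ÷₀ (ι (m C k d) ^ n d)) (+ m))) 0)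
    × (probX m c n k i
      ≡ ι (m C i) * Σ≤ (m ∸ i) (λ j → ((- 1ℚ) ^ j) * ι ((m ∸ i) C j)
          * ∏ c (λ d → Σ≤ (i +ℕ j) (λ l → ((- 1ℚ) ^ l) * ι ((i +ℕ j) C l)
              * ((ι ((m ∸ l) C k d) ÷₀ ι (m C k d)) ^ n d))))))
  × ((r : ℕ) → expBinomX m c n k r
      ≡ ι (m C r) * ∏ c (λ d → ∇^ r (λ x → (binom x (k d) ÷₀ ι (m C k d)) ^ n d) (+ m)))
theorem2p12 m c _ _ n k _ =
  (λ i i≤m → probability-as-differences i i≤m , probability-as-sums i i≤m) , binomial-moment
  where open CommitteeModel m c n k
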